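{- Let $G$ and $H$ be nontrivial graphs with $G$ connected, let $k\in\{2,\ldots,n(G)\cdot n(H)-1\}$, and set $j=\lceil k/n(H)\rceil$ and $\ell=\min\{k,n(G)\}$. If $k\le n(H)$, then $${\rm sgp}_k(G\circ H)\ge \max_{S\in\mathcal{G}_{2,k}}\big\{|\mathcal{I}_S|\,{\rm sjc}_k(H)+|\mathcal{J}_S|\,s\omega_k(H)\big\},$$ and if $n(H)<k<n(G)\cdot n(H)$, then ${\rm sgp}_k(G\circ H)\ge {\rm sgp}_{[j:\ell]}(G)\cdot n(H)$. Moreover, if $k>(n(G)-1)n(H)$, then ${\rm sgp}_k(G\circ H)={\rm sgp}_{[j:\ell]}(G)\cdot n(H)$.
   Context: Graphs are finite and simple; nontrivial means at least two vertices; $n(G)$ is the number of vertices. The lexicographic product $G\circ H$ has vertex set $V(G)\times V(H)$, with $(g,h)$ adjacent to $(g',h')$ iff $gg'\in E(G)$, or $g=g'$ and $hh'\in E(H)$. For nonempty $W\subseteq V(X)$ of a graph $X$, the Steiner distance $d_X(W)$ is the minimum number of edges of a connected subgraph containing $W$ ($\infty$ if none); such a minimum subgraph is a tree, a Steiner $W$-tree. For a positive integer $k$, $A\subseteq V(X)$ is a $k$-Steiner general position set if for every $k$-subset $B\subseteq A$ and every Steiner $B$-tree $T_B$, $V(T_B)\cap A=B$; ${\rm sgp}_k(X)$ is the largest size of such a set. For $a\le b$, a $[a:b]$-Steiner general position set is a set that is a $t$-Steiner general position set for every integer $t$ with $a\le t\le b$; ${\rm sgp}_{[a:b]}(X)$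 is the largest size of such a set, and $\mathcal{G}_{a,b}$ is the family of all $[a:b]$-Steiner general position sets of $G$. For $S\subseteq V(G)$, $\mathcal{I}_S$ is the set of isolated vertices of the induced subgraph $G[S]$ and $\mathcal{J}_S=S\setminus\mathcal{I}_S$. For $k\ge 2$, a $k$-Steiner clique of $H$ is a set $A$ with $H[B]$ connected for every $k$-subset $B\subseteq A$ (sets of size $<k$ qualify trivially), and $s\omega_k(H)$ is the largest size of one. A set $A\subseteq V(H)$ with $|A|\ge k$ is $k$-Steiner join-critical if $d_{H[A]}(B)\ne k$ for every $k$-subset $B\subseteq A$; ${\rm sjc}_k(H)$ is the largest size of such a set. -}

module Defs where

open import Data.Nat using (ℕ; zero; suc; _+_; _*_; _≤_; _<_; _/_)
open import Data.Bool using (Bool; true; false; _∧_; _∨_; not)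
open import Data.Fin using (Fin; toℕ; remQuot)
open import Data.Fin.Properties using (_≟_)
open import Data.Fin.Subset using (Subset; ∣_∣; _⊆_; _∩_; _─_; ⊤)
import Data.Fin.Subset as Sub
open import Data.Vec using (Vec; tabulate; lookup; foldr)
open import Data.Product using (Σ; _×_; _,_; proj₁; proj₂; ∃)
open import Data.Sum using (_⊎_)
open import Data.List using (List; length)
import Data.List.Membership.Propositional as LMem
open import Data.List.Relation.Unary.Unique.Propositional using (Unique)
open import Relation.Nullary using (¬_; Dec; yes; no)
open import Relation.Nullary.Decidable using (⌊_⌋)
open import Relation.Binary.PropositionalEquality using (_≡_; refl; sym; cong)

record Graph : Set where
  field
    n      : ℕ
    adj    : Fin n → Fin n → Bool
    adj-sym    : ∀ i j → adj i j ≡ adj j i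
    adj-irrefl : ∀ i → adj i i ≡ false
open Graph public

data Walk {n : ℕ} (E : Fin n → Fin n → Set) : Fin n → Fin n → Set where
  here : ∀ {u} → Walk E u u
  step : ∀ {u w v} → E u w → Walk E w v → Walk E u v

Edge : (X : Graph) → Fin (n X) → Fin (n X) → Set
Edge X u v = adj X u v ≡ true

Nontrivial : Graph → Set
Nontrivial X = 2 ≤ n X

Connected : Graph → Set
Connected X = ∀ u v → Walk (Edge X) u v

-- Lexicographic product G ∘ H, vertex (g , h) encoded in Fin (n G * n H)
-- via remQuot / combine.

private
  eqb : ∀ {m} → Fin m → Fin m → Bool
  eqb a b = ⌊ a ≟ b ⌋

  eqb-sym : ∀ {m} (a b : Fin m) → eqb a b ≡ eqb b a
  eqb-sym a b with a ≟ b | b ≟ a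
  ... | yes _ | yes _ = refl
  ... | no _  | no _  = refl
  ... | yes p | no q  = Data.Empty.⊥-elim (q (sym p))
    where import Data.Empty
  ... | no p  | yes q = Data.Empty.⊥-elim (p (sym q))
    where import Data.Empty

  eqb-refl : ∀ {m} (a : Fin m) → eqb a a ≡ true
  eqb-refl a with a ≟ a
  ... | yes _ = refl
  ... | no p  = Data.Empty.⊥-elim (p refl)
    where import Data.Empty

  lexAdjPair : (G H : Graph) → (Fin (n G) × Fin (n H)) → (Fin (n G) × Fin (n H)) → Bool
  lexAdjPair G H (g , h) (g' , h') = adj G g g' ∨ (eqb g g' ∧ adj H h h')

  lexAdjPair-sym : (G H : Graph) → ∀ p q → lexAdjPair G H p q ≡ lexAdjPair G H q p
  lexAdjPair-sym G H (g , h) (g' , h')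
    rewrite adj-sym G g g' | eqb-sym g g' | adj-sym H h h' = refl

  lexAdjPair-irrefl : (G H : Graph) → ∀ p → lexAdjPair G H p p ≡ false
  lexAdjPair-irrefl G H (g , h)
    rewrite adj-irrefl G g | eqb-refl g | adj-irrefl H h = refl

lex : Graph → Graph → Graph
lex G H = record
  { n = n G * n H
  ; adj = λ x y → lexAdjPair G H (remQuot (n H) x) (remQuot (n H) y)
  ; adj-sym = λ x y → lexAdjPair-sym G H (remQuot (n H) x) (remQuot (n H) y)
  ; adj-irrefl = λ x → lexAdjPair-irrefl G H (remQuot (n H) x)
  }

-- Subgraphs: a vertex set together with a duplicate-free list of edges,
-- each edge listed once as (i , j) with toℕ i < toℕ j.

record Subgraph (X : Graph) : Set where
  field
    vs : Subset (n X)
    es : List (Fin (n X) × Fin (n X))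
    es-unique : Unique es
    es-edges  : ∀ {i j} → (i , j) LMem.∈ es →
                  (toℕ i < toℕ j) × Edge X i j × i Sub.∈ vs × j Sub.∈ vs
open Subgraph public

nEdges : ∀ {X} → Subgraph X → ℕ
nEdges T = length (es T)

SubEdge : ∀ {X} → Subgraph X → Fin (n X) → Fin (n X) → Set
SubEdge T u v = ((u , v) LMem.∈ es T) ⊎ ((v , u) LMem.∈ es T)

SubConnected : ∀ {X} → Subgraph X → Set
SubConnected T = ∀ {u v} → u Sub.∈ vs T → v Sub.∈ vs T → Walk (SubEdge T) u v

-- T is a connected subgraph of the induced subgraph X[A] containing W.
-- (Subgraphs of X[A] are exactly the subgraphs of X with vertices in A.)
ConnSubIn : (X : Graph) → Subset (n X) → Subset (n X) → Subgraph X → Set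
ConnSubIn X A W T = (vs T ⊆ A) × (W ⊆ vs T) × SubConnected T

SteinerDistEq : (X : Graph) → Subset (n X) → Subset (n X) → ℕ → Set
SteinerDistEq X A W m =
  (Σ (Subgraph X) λ T → ConnSubIn X A W T × nEdges T ≡ m) ×
  (∀ T → ConnSubIn X A W T → m ≤ nEdges T)

SteinerTree : (X : Graph) → Subset (n X) → Subgraph X → Set
SteinerTree X W T =
  ConnSubIn X ⊤ W T × (∀ T' → ConnSubIn X ⊤ W T' → nEdges T ≤ nEdges T')

SGP : (X : Graph) → ℕ → Subset (n X) → Set
SGP X k A = ∀ B → B ⊆ A → ∣ B ∣ ≡ k → ∀ T → SteinerTree X B T → vs T ∩ A ≡ B

SGPRange : (X : Graph) → ℕ → ℕ → Subset (n X) → Set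
SGPRange X a b A = ∀ t → a ≤ t → t ≤ b → SGP X t A

InducedConnected : (X : Graph) → Subset (n X) → Set
InducedConnected X B =
  ∀ {u v} → u Sub.∈ B → v Sub.∈ B →
    Walk (λ a b → Edge X a b × b Sub.∈ B) u v

SteinerClique : (X : Graph) → ℕ → Subset (n X) → Set
SteinerClique X k A = ∀ B → B ⊆ A → ∣ B ∣ ≡ k → InducedConnected X B

SJC : (X : Graph) → ℕ → Subset (n X) → Set
SJC X k A = (k ≤ ∣ A ∣) × (∀ B → B ⊆ A → ∣ B ∣ ≡ k → ¬ SteinerDistEq X A B k)

IsMaxSize : ∀ {m} → (Subset m → Set) → ℕ → Set
IsMaxSize {m} P s = (Σ (Subset m) λ A → P A × ∣ A ∣ ≡ s) × (∀ A → P A → ∣ A ∣ ≤ s)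

anyB : ∀ {m} → (Fin m → Bool) → Bool
anyB f = foldr _ _∨_ false (tabulate f)

isolated : (X : Graph) → Subset (n X) → Subset (n X)
isolated X S = tabulate λ v → lookup S v ∧ not (anyB λ u → lookup S u ∧ adj X u v)

nonIsolated : (X : Graph) → Subset (n X) → Subset (n X)
nonIsolated X S = S ─ isolated X S

-- ceiling division ⌈ k / m ⌉ (m > 0; value 0 for m = 0, never used)
ceilDiv : ℕ → ℕ → ℕ
ceilDiv k zero = 0
ceilDiv k (suc m) = (k + m) / suc m

module Submission where

-- Write π for the projection of V(G ∘ H) onto V(G), let B be a k-set and T a Steiner B-tree
-- with vertex set Q. Counting Q fibrewise gives k + |π(Q)| ≤ |Q| + |π(B)|, while adding one
-- vertex over each g ∈ U ∖ π(B) turns any connected U ⊇ π(B) of G into a connected superset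
-- of B in G ∘ H, so |Q| + |π(B)| ≤ k + |U|. Hence π(Q) is a smallest connected set containing
-- π(B): if S is a |π(B)|-Steiner general position set of G, then π(Q) ∩ S = π(B), and the
-- first inequality becomes strict as soon as Q meets S × V(H) outside B. This settles every B
-- with |π(B)| ≥ 2, for S × V(H) as well as for (I_S × A₀) ∪ (J_S × C₀). A set B inside one
-- fibre over g ∈ J_S is connected because C₀ is a k-Steiner clique; over g ∈ I_S, a vertex of
-- T outside B would give its fibre Steiner distance k in H[A₀]. When k > (n(G) − 1) n(H),
-- every k-set meets all fibres, so it is connected and the whole vertex set is in general
-- position.

open import Level using (0ℓ)
open import Data.Nat using (ℕ; zero; suc; _+_; _*_; _∸_; _≤_; _<_; _⊓_; _/_; z≤n; s≤s; s≤s⁻¹; _≤?_)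
open import Data.Nat.Properties
  using (module ≤-Reasoning; ≤-refl; ≤-reflexive; ≤-trans; ≤-antisym; <⇒≱; ≰⇒>; <-cmp; +-suc; +-comm; +-assoc;
         +-identityʳ; +-monoˡ-≤; +-monoʳ-≤; +-mono-≤; +-monoʳ-<; +-cancelˡ-≤; m≤n⇒m≤1+n; m≤n+m; n<1+n;
         *-monoˡ-≤; *-identityˡ; *-identityʳ; ⊓-glb; m⊓n≤n)
open import Data.Nat.DivMod using (m<n*o⇒m/o<n; m*n/n≡m; /-monoˡ-≤)
open import Data.Nat.Tactic.RingSolver using (solve-∀)
open import Data.Bool using (Bool; true; false; _∧_; _∨_; not; if_then_else_)
open import Data.Bool.Properties using (∧-conicalˡ; ∧-conicalʳ; ∨-conicalˡ; ∨-conicalʳ; ∨-zeroʳ)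
open import Data.Fin using (Fin; zero; suc; toℕ; combine; quotient; remainder)
open import Data.Fin.Properties using (_≟_; any?; toℕ-injective; combine-remQuot; remQuot-combine)
open import Data.Fin.Subset
open import Data.Fin.Subset.Properties
open import Data.Vec using ([]; _∷_; _++_; tabulate; lookup; here; there)
open import Data.Vec.Properties
  using ([]=⇒lookup; lookup⇒[]=; lookup∘tabulate; lookup-++ˡ; lookup-++ʳ; lookup-replicate)
open import Data.List using (List; []; _∷_; length)
open import Data.List.Membership.Propositional using () renaming (_∈_ to _∈ₗ_)
open import Data.List.Relation.Unary.Any using (here; there)
open import Data.List.Relation.Unary.All using () renaming (tabulate to tabulateᴬ)
open import Data.List.Relation.Unary.AllPairs using ([]; _∷_)
open import Data.Product using (Σ; ∃; ∃₂; _×_; _,_; proj₁; proj₂)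
open import Data.Sum using (_⊎_; inj₁; inj₂; [_,_]′; map₂)
import Data.Empty
open import Function using (id; _∘_)
open import Relation.Unary using (Pred; Decidable)
open import Relation.Nullary using (¬_; Dec; yes; no; does; contradiction; _×-dec_; ¬?)
open import Relation.Nullary.Decidable using (⌊_⌋; dec-true; isYes≗does; decidable-stable)
open import Relation.Binary.Definitions using (tri<; tri≈; tri>)
open import Relation.Binary.PropositionalEquality hiding (J)

open import Defs

private variable
  a b : ℕ
  p q : Subset a
  x y : Fin a

∈⇒lookup : x ∈ p → lookup p x ≡ true
∈⇒lookup = []=⇒lookup

lookup⇒∈ : lookup p x ≡ true → x ∈ p
lookup⇒∈ {p = p} {x} = lookup⇒[]= x p

⟦_⟧ : {P : Pred (Fin a) 0ℓ} → Decidable P → Subset a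
⟦ P? ⟧ = tabulate (does ∘ P?)

∈⟦⟧⁺ : {P : Pred (Fin a) 0ℓ} (P? : Decidable P) → P x → x ∈ ⟦ P? ⟧
∈⟦⟧⁺ {x = x} P? px = lookup⇒∈ (trans (lookup∘tabulate _ x) (dec-true (P? x) px))

∈⟦⟧⁻ : {P : Pred (Fin a) 0ℓ} (P? : Decidable P) → x ∈ ⟦ P? ⟧ → P x
∈⟦⟧⁻ {x = x} P? x∈ = true⇒ (P? x) (trans (sym (lookup∘tabulate _ x)) (∈⇒lookup x∈))
  where
  true⇒ : ∀ {A : Set} (a? : Dec A) → does a? ≡ true → A
  true⇒ (yes a) _ = a

x∈p─q⁻ : x ∈ p ─ q → x ∈ p × x ∉ q
x∈p─q⁻ {p = _ ∷ _} {q = outside ∷ _} here = here , λ ()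
x∈p─q⁻ {p = _ ∷ _} {q = _ ∷ _} (there x∈) =
  there (proj₁ (x∈p─q⁻ x∈)) , λ { (there x∈q) → proj₂ (x∈p─q⁻ x∈) x∈q }

Image : (Fin a → Fin b) → Subset a → Pred (Fin b) 0ℓ
Image f p y = ∃ λ x → x ∈ p × f x ≡ y

image? : (f : Fin a → Fin b) (p : Subset a) → Decidable (Image f p)
image? f p y = any? (λ x → x ∈? p ×-dec f x ≟ y)

image : (Fin a → Fin b) → Subset a → Subset b
image f p = ⟦ image? f p ⟧

∈image⁺ : (f : Fin a → Fin b) → x ∈ p → f x ∈ image f p
∈image⁺ {p = p} f x∈p = ∈⟦⟧⁺ (image? f p) (_ , x∈p , refl)

∈image⁻ : (f : Fin a → Fin b) (p : Subset a) → y ∈ image f p → Image f p y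
∈image⁻ f p = ∈⟦⟧⁻ (image? f p)

Disjoint : Subset a → Subset a → Set
Disjoint p q = ∀ {x} → x ∈ p → x ∉ q

∣p∪q∣≤∣p∣+∣q∣ : (p q : Subset a) → ∣ p ∪ q ∣ ≤ ∣ p ∣ + ∣ q ∣
∣p∪q∣≤∣p∣+∣q∣ []            []            = z≤n
∣p∪q∣≤∣p∣+∣q∣ (outside ∷ p) (outside ∷ q) = ∣p∪q∣≤∣p∣+∣q∣ p q
∣p∪q∣≤∣p∣+∣q∣ (outside ∷ p) (inside  ∷ q) =
  ≤-trans (s≤s (∣p∪q∣≤∣p∣+∣q∣ p q)) (≤-reflexive (sym (+-suc ∣ p ∣ ∣ q ∣)))
∣p∪q∣≤∣p∣+∣q∣ (inside  ∷ p) (outside ∷ q) = s≤s (∣p∪q∣≤∣p∣+∣q∣ p q)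
∣p∪q∣≤∣p∣+∣q∣ (inside  ∷ p) (inside  ∷ q) =
  s≤s (≤-trans (∣p∪q∣≤∣p∣+∣q∣ p q) (+-monoʳ-≤ ∣ p ∣ (m≤n⇒m≤1+n ≤-refl)))

∣p∪q∣≡∣p∣+∣q∣ : (p q : Subset a) → Disjoint p q → ∣ p ∪ q ∣ ≡ ∣ p ∣ + ∣ q ∣
∣p∪q∣≡∣p∣+∣q∣ []            []            _ = refl
∣p∪q∣≡∣p∣+∣q∣ (outside ∷ p) (outside ∷ q) d = ∣p∪q∣≡∣p∣+∣q∣ p q (λ x∈p x∈q → d (there x∈p) (there x∈q))
∣p∪q∣≡∣p∣+∣q∣ (outside ∷ p) (inside  ∷ q) d =
  trans (cong suc (∣p∪q∣≡∣p∣+∣q∣ p q (λ x∈p x∈q → d (there x∈p) (there x∈q)))) (sym (+-suc ∣ p ∣ ∣ q ∣))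
∣p∪q∣≡∣p∣+∣q∣ (inside  ∷ p) (outside ∷ q) d = cong suc (∣p∪q∣≡∣p∣+∣q∣ p q (λ x∈p x∈q → d (there x∈p) (there x∈q)))
∣p∪q∣≡∣p∣+∣q∣ (inside  ∷ p) (inside  ∷ q) d = contradiction here (d here)

∣p∣≡∣p∩q∣+∣p─q∣ : (p q : Subset a) → ∣ p ∣ ≡ ∣ p ∩ q ∣ + ∣ p ─ q ∣
∣p∣≡∣p∩q∣+∣p─q∣ []            []            = refl
∣p∣≡∣p∩q∣+∣p─q∣ (outside ∷ p) (outside ∷ q) = ∣p∣≡∣p∩q∣+∣p─q∣ p q
∣p∣≡∣p∩q∣+∣p─q∣ (outside ∷ p) (inside  ∷ q) = ∣p∣≡∣p∩q∣+∣p─q∣ p q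
∣p∣≡∣p∩q∣+∣p─q∣ (inside  ∷ p) (inside  ∷ q) = cong suc (∣p∣≡∣p∩q∣+∣p─q∣ p q)
∣p∣≡∣p∩q∣+∣p─q∣ (inside  ∷ p) (outside ∷ q) =
  trans (cong suc (∣p∣≡∣p∩q∣+∣p─q∣ p q)) (sym (+-suc ∣ p ∩ q ∣ ∣ p ─ q ∣))

p⊆q⇒p∩q≡p : p ⊆ q → p ∩ q ≡ p
p⊆q⇒p∩q≡p {p = p} {q = q} p⊆q = ⊆-antisym (p∩q⊆p p q) (λ x∈p → x∈p∩q⁺ (x∈p , p⊆q x∈p))

q⊆p⇒∣p∣≡∣q∣+∣p─q∣ : q ⊆ p → ∣ p ∣ ≡ ∣ q ∣ + ∣ p ─ q ∣
q⊆p⇒∣p∣≡∣q∣+∣p─q∣ {q = q} {p = p} q⊆p =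
  trans (∣p∣≡∣p∩q∣+∣p─q∣ p q) (cong (λ s → ∣ s ∣ + ∣ p ─ q ∣) (trans (∩-comm p q) (p⊆q⇒p∩q≡p q⊆p)))

p⊆q⇒∣q∣≤∣p∣⇒p≡q : p ⊆ q → ∣ q ∣ ≤ ∣ p ∣ → p ≡ q
p⊆q⇒∣q∣≤∣p∣⇒p≡q {p = p} {q = q} p⊆q ∣q∣≤∣p∣ = ⊆-antisym p⊆q q⊆p
  where
  q⊆p : q ⊆ p
  q⊆p {x} x∈q = decidable-stable (x ∈? p) λ x∉p → <⇒≱ (p⊂q⇒∣p∣<∣q∣ (p⊆q , x , x∈q , x∉p)) ∣q∣≤∣p∣

∣p∪⁅x⁆∣≡1+∣p∣ : x ∉ p → ∣ p ∪ ⁅ x ⁆ ∣ ≡ suc ∣ p ∣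
∣p∪⁅x⁆∣≡1+∣p∣ {x = x} {p = p} x∉p =
  trans (∣p∪q∣≡∣p∣+∣q∣ p ⁅ x ⁆ (λ y∈p y∈⁅x⁆ → x∉p (subst (_∈ p) (x∈⁅y⁆⇒x≡y x y∈⁅x⁆) y∈p)))
        (trans (cong (∣ p ∣ +_) (∣⁅x⁆∣≡1 x)) (+-comm ∣ p ∣ 1))

x∈p∪⁅y⁆⁻ : x ∈ p ∪ ⁅ y ⁆ → x ∈ p ⊎ x ≡ y
x∈p∪⁅y⁆⁻ {p = p} {y = y} x∈ = map₂ (x∈⁅y⁆⇒x≡y y) (x∈p∪q⁻ p ⁅ y ⁆ x∈)

∣image∣≤∣p∣ : (f : Fin a → Fin b) (p : Subset a) → ∣ image f p ∣ ≤ ∣ p ∣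
∣image∣≤∣p∣ {b = b} f [] = ≤-reflexive (trans (cong ∣_∣ (Empty-unique nothing)) (∣⊥∣≡0 b))
  where
  nothing : Empty (image f [])
  nothing (y , y∈) with ∈image⁻ f [] y∈
  ... | () , _
∣image∣≤∣p∣ f (outside ∷ p) = ≤-trans (p⊆q⇒∣p∣≤∣q∣ ⊆tail) (∣image∣≤∣p∣ (f ∘ suc) p)
  where
  ⊆tail : image f (outside ∷ p) ⊆ image (f ∘ suc) p
  ⊆tail y∈ with ∈image⁻ f (outside ∷ p) y∈
  ... | suc x , there x∈p , refl = ∈image⁺ (f ∘ suc) x∈p
∣image∣≤∣p∣ f (inside ∷ p) = begin
  ∣ image f (inside ∷ p) ∣                        ≤⟨ p⊆q⇒∣p∣≤∣q∣ ⊆head∪tail ⟩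
  ∣ ⁅ f zero ⁆ ∪ image (f ∘ suc) p ∣              ≤⟨ ∣p∪q∣≤∣p∣+∣q∣ ⁅ f zero ⁆ _ ⟩
  ∣ ⁅ f zero ⁆ ∣ + ∣ image (f ∘ suc) p ∣          ≡⟨ cong (_+ ∣ image (f ∘ suc) p ∣) (∣⁅x⁆∣≡1 (f zero)) ⟩
  suc ∣ image (f ∘ suc) p ∣                       ≤⟨ s≤s (∣image∣≤∣p∣ (f ∘ suc) p) ⟩
  suc ∣ p ∣                                       ∎
  where
  open ≤-Reasoning
  ⊆head∪tail : image f (inside ∷ p) ⊆ ⁅ f zero ⁆ ∪ image (f ∘ suc) p
  ⊆head∪tail y∈ with ∈image⁻ f (inside ∷ p) y∈
  ... | zero  , _          , refl = x∈p∪q⁺ (inj₁ (x∈⁅x⁆ (f zero)))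
  ... | suc x , there x∈p , refl = x∈p∪q⁺ (inj₂ (∈image⁺ (f ∘ suc) x∈p))

1≤∣p∣⇒Nonempty : ∀ {n} {p : Subset n} → 1 ≤ ∣ p ∣ → Nonempty p
1≤∣p∣⇒Nonempty {n} {p} 1≤∣p∣ with nonempty? p
... | yes p≠∅ = p≠∅
... | no  p=∅ with subst (1 ≤_) (trans (cong ∣_∣ (Empty-unique p=∅)) (∣⊥∣≡0 n)) 1≤∣p∣
... | ()

2≤∣p∣⇒∃≢ : 2 ≤ ∣ p ∣ → ∃₂ λ x y → x ∈ p × y ∈ p × x ≢ y
2≤∣p∣⇒∃≢ {p = p} 2≤∣p∣ with 1≤∣p∣⇒Nonempty (≤-trans (s≤s z≤n) 2≤∣p∣)
... | x , x∈p with any? (λ y → y ∈? p ×-dec ¬? (y ≟ x))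
...   | yes (y , y∈p , y≢x) = x , y , x∈p , y∈p , y≢x ∘ sym
...   | no  none            = contradiction (≤-trans 2≤∣p∣ ∣p∣≤1) λ { (s≤s ()) }
  where
  p⊆⁅x⁆ : p ⊆ ⁅ x ⁆
  p⊆⁅x⁆ {y} y∈p = subst (_∈ ⁅ x ⁆) (sym (decidable-stable (y ≟ x) λ y≢x → none (y , y∈p , y≢x))) (x∈⁅x⁆ x)
  ∣p∣≤1 : ∣ p ∣ ≤ 1
  ∣p∣≤1 = ≤-trans (p⊆q⇒∣p∣≤∣q∣ p⊆⁅x⁆) (≤-reflexive (∣⁅x⁆∣≡1 x))

∃≢⇒2≤∣p∣ : x ∈ p → y ∈ p → x ≢ y → 2 ≤ ∣ p ∣
∃≢⇒2≤∣p∣ {x = x} {p = p} {y = y} x∈p y∈p x≢y = begin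
  2                   ≡⟨ cong suc (∣⁅x⁆∣≡1 x) ⟨
  suc ∣ ⁅ x ⁆ ∣       ≡⟨ ∣p∪⁅x⁆∣≡1+∣p∣ (λ y∈⁅x⁆ → x≢y (sym (x∈⁅y⁆⇒x≡y x y∈⁅x⁆))) ⟨
  ∣ ⁅ x ⁆ ∪ ⁅ y ⁆ ∣   ≤⟨ p⊆q⇒∣p∣≤∣q∣ ⁅x⁆∪⁅y⁆⊆p ⟩
  ∣ p ∣               ∎
  where
  open ≤-Reasoning
  ⁅x⁆∪⁅y⁆⊆p : ⁅ x ⁆ ∪ ⁅ y ⁆ ⊆ p
  ⁅x⁆∪⁅y⁆⊆p z∈ with x∈p∪q⁻ ⁅ x ⁆ ⁅ y ⁆ z∈
  ... | inj₁ z∈⁅x⁆ = subst (_∈ p) (sym (x∈⁅y⁆⇒x≡y x z∈⁅x⁆)) x∈p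
  ... | inj₂ z∈⁅y⁆ = subst (_∈ p) (sym (x∈⁅y⁆⇒x≡y y z∈⁅y⁆)) y∈p

infixr 7 _⊠_

-- The product p × q, laid out along Data.Fin.combine.
_⊠_ : Subset a → Subset b → Subset (a * b)
[]            ⊠ q = []
(inside  ∷ p) ⊠ q = q ++ p ⊠ q
(outside ∷ p) ⊠ q = ⊥ ++ p ⊠ q

∣p++q∣≡∣p∣+∣q∣ : (p : Subset a) (q : Subset b) → ∣ p ++ q ∣ ≡ ∣ p ∣ + ∣ q ∣
∣p++q∣≡∣p∣+∣q∣ []            q = refl
∣p++q∣≡∣p∣+∣q∣ (inside  ∷ p) q = cong suc (∣p++q∣≡∣p∣+∣q∣ p q)
∣p++q∣≡∣p∣+∣q∣ (outside ∷ p) q = ∣p++q∣≡∣p∣+∣q∣ p q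

∣p⊠q∣≡∣p∣*∣q∣ : ∀ {m n} (p : Subset m) (q : Subset n) → ∣ p ⊠ q ∣ ≡ ∣ p ∣ * ∣ q ∣
∣p⊠q∣≡∣p∣*∣q∣ []            q = refl
∣p⊠q∣≡∣p∣*∣q∣ (inside  ∷ p) q = trans (∣p++q∣≡∣p∣+∣q∣ q (p ⊠ q)) (cong (∣ q ∣ +_) (∣p⊠q∣≡∣p∣*∣q∣ p q))
∣p⊠q∣≡∣p∣*∣q∣ {n = n} (outside ∷ p) q =
  trans (∣p++q∣≡∣p∣+∣q∣ (⊥ {n}) (p ⊠ q)) (cong₂ _+_ (∣⊥∣≡0 n) (∣p⊠q∣≡∣p∣*∣q∣ p q))

lookup-⊠ : ∀ {m n} (p : Subset m) (q : Subset n) (i : Fin m) (j : Fin n) →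
           lookup (p ⊠ q) (combine i j) ≡ lookup p i ∧ lookup q j
lookup-⊠ (inside  ∷ p) q zero    j = lookup-++ˡ q (p ⊠ q) j
lookup-⊠ {n = n} (outside ∷ p) q zero    j = trans (lookup-++ˡ (⊥ {n}) (p ⊠ q) j) (lookup-replicate j outside)
lookup-⊠ (inside  ∷ p) q (suc i) j = trans (lookup-++ʳ q (p ⊠ q) (combine i j)) (lookup-⊠ p q i j)
lookup-⊠ {n = n} (outside ∷ p) q (suc i) j = trans (lookup-++ʳ (⊥ {n}) (p ⊠ q) (combine i j)) (lookup-⊠ p q i j)

module _ {m n : ℕ} {p : Subset m} {q : Subset n} {i : Fin m} {j : Fin n} where

  combine∈⊠⁺ : i ∈ p → j ∈ q → combine i j ∈ p ⊠ q
  combine∈⊠⁺ i∈p j∈q =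
    lookup⇒∈ (trans (lookup-⊠ p q i j) (cong₂ _∧_ (∈⇒lookup i∈p) (∈⇒lookup j∈q)))

  combine∈⊠⁻ : combine i j ∈ p ⊠ q → i ∈ p × j ∈ q
  combine∈⊠⁻ ij∈ = lookup⇒∈ (∧-conicalˡ _ _ pi∧qj) , lookup⇒∈ (∧-conicalʳ _ _ pi∧qj)
    where
    pi∧qj : lookup p i ∧ lookup q j ≡ true
    pi∧qj = trans (sym (lookup-⊠ p q i j)) (∈⇒lookup ij∈)

module _ {m n : ℕ} {p : Subset m} {q : Subset n} {x : Fin (m * n)} where

  ∈⊠⁺ : quotient n x ∈ p → remainder {m} n x ∈ q → x ∈ p ⊠ q
  ∈⊠⁺ x₁∈p x₂∈q = subst (_∈ p ⊠ q) (combine-remQuot {m} n x) (combine∈⊠⁺ x₁∈p x₂∈q)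

  ∈⊠⁻ : x ∈ p ⊠ q → quotient n x ∈ p × remainder {m} n x ∈ q
  ∈⊠⁻ x∈ = combine∈⊠⁻ (subst (_∈ p ⊠ q) (sym (combine-remQuot {m} n x)) x∈)

mapWalk : ∀ {m} {E F : Fin m → Fin m → Set} → (∀ {a b} → E a b → F a b) →
          ∀ {u v} → Walk E u v → Walk F u v
mapWalk f here       = here
mapWalk f (step e w) = step (f e) (mapWalk f w)

infixr 5 _++ᵂ_

_++ᵂ_ : ∀ {m} {E : Fin m → Fin m → Set} {u v w} → Walk E u v → Walk E v w → Walk E u w
here       ++ᵂ q = q
step e p ++ᵂ q = step e (p ++ᵂ q)

firstStep : ∀ {m} {E : Fin m → Fin m → Set} {u v} → Walk E u v → u ≢ v → ∃ (E u)
firstStep here       u≢v = contradiction refl u≢v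
firstStep (step e _) _   = _ , e

module _ (X : Graph) where

  Edge-sym : ∀ {u v} → Edge X u v → Edge X v u
  Edge-sym {u} {v} e = trans (adj-sym X v u) e

  Edge⇒≢ : ∀ {u v} → Edge X u v → u ≢ v
  Edge⇒≢ {u} e refl with trans (sym e) (adj-irrefl X u)
  ... | ()

  InducedEdge : Subset (n X) → Fin (n X) → Fin (n X) → Set
  InducedEdge B a b = Edge X a b × b ∈ B

  Connected⇒InducedConnected⊤ : Connected X → InducedConnected X ⊤
  Connected⇒InducedConnected⊤ conn {u} {v} _ _ = mapWalk (λ e → e , ∈⊤) (conn u v)

  neighbourIn : ∀ {U} → InducedConnected X U → 2 ≤ ∣ U ∣ →
                ∀ {u} → u ∈ U → ∃ λ v → Edge X u v × v ∈ U
  neighbourIn conn 2≤∣U∣ {u} u∈U with 2≤∣p∣⇒∃≢ 2≤∣U∣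
  ... | a , b , a∈U , b∈U , a≢b with u ≟ a
  ...   | yes refl = firstStep (conn u∈U b∈U) a≢b
  ...   | no  u≢a  = firstStep (conn u∈U a∈U) u≢a

  star-connected : ∀ {B c} → (∀ {x} → x ∈ B → Edge X c x) → InducedConnected X (B ∪ ⁅ c ⁆)
  star-connected {B} {c} c-B x∈ y∈ = toCentre x∈ ++ᵂ fromCentre y∈
    where
    c∈ : c ∈ B ∪ ⁅ c ⁆
    c∈ = x∈p∪q⁺ (inj₂ (x∈⁅x⁆ c))
    toCentre : ∀ {x} → x ∈ B ∪ ⁅ c ⁆ → Walk (InducedEdge (B ∪ ⁅ c ⁆)) x c
    toCentre x∈ with x∈p∪q⁻ B ⁅ c ⁆ x∈
    ... | inj₁ x∈B   = step (Edge-sym (c-B x∈B) , c∈) here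
    ... | inj₂ x∈⁅c⁆ rewrite x∈⁅y⁆⇒x≡y c x∈⁅c⁆ = here
    fromCentre : ∀ {x} → x ∈ B ∪ ⁅ c ⁆ → Walk (InducedEdge (B ∪ ⁅ c ⁆)) c x
    fromCentre x∈ with x∈p∪q⁻ B ⁅ c ⁆ x∈
    ... | inj₁ x∈B   = step (c-B x∈B , x∈) here
    ... | inj₂ x∈⁅c⁆ rewrite x∈⁅y⁆⇒x≡y c x∈⁅c⁆ = here

  SubEdge⇒Edge : ∀ (T : Subgraph X) {u v} → SubEdge T u v → Edge X u v × u ∈ vs T × v ∈ vs T
  SubEdge⇒Edge T (inj₁ uv∈) with es-edges T uv∈
  ... | _ , e , u∈ , v∈ = e , u∈ , v∈
  SubEdge⇒Edge T (inj₂ vu∈) with es-edges T vu∈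
  ... | _ , e , v∈ , u∈ = Edge-sym e , u∈ , v∈

  SubConnected⇒InducedConnected : ∀ (T : Subgraph X) → SubConnected T → InducedConnected X (vs T)
  SubConnected⇒InducedConnected T conn u∈ v∈ =
    mapWalk (λ s → let e , _ , w∈ = SubEdge⇒Edge T s in e , w∈) (conn u∈ v∈)

module _ {m : ℕ} where

  Link : List (Fin m × Fin m) → Fin m → Fin m → Set
  Link es u v = (u , v) ∈ₗ es ⊎ (v , u) ∈ₗ es

  merge : Fin m → Fin m → Fin m → Fin m
  merge a b l = if does (l ≟ a) then b else l

  merge-≢ : ∀ {a b l} → l ≢ a → merge a b l ≡ l
  merge-≢ {a} {b} {l} l≢a with l ≟ a
  ... | yes l≡a = contradiction l≡a l≢a
  ... | no  _   = refl

  merge-merges : ∀ a b → merge a b a ≡ merge a b b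
  merge-merges a b with a ≟ a | b ≟ a
  ... | no a≢a | _        = contradiction refl a≢a
  ... | yes _  | yes refl = refl
  ... | yes _  | no  _    = refl

  -- label es assigns to each vertex a representative of its component in the graph with edges es,
  -- merging classes one edge at a time as in union–find.
  label : List (Fin m × Fin m) → Fin m → Fin m
  label []             = id
  label ((a , b) ∷ es) = merge (label es a) (label es b) ∘ label es

  label-∈ : ∀ es {u v} → (u , v) ∈ₗ es → label es u ≡ label es v
  label-∈ ((a , b) ∷ es) (here refl) = merge-merges (label es a) (label es b)
  label-∈ ((a , b) ∷ es) (there uv∈) = cong (merge (label es a) (label es b)) (label-∈ es uv∈)

  label-walk : ∀ es {u v} → Walk (Link es) u v → label es u ≡ label es v
  label-walk es here                = refl
  label-walk es (step (inj₁ uw∈) w) = trans (label-∈ es uw∈) (label-walk es w)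
  label-walk es (step (inj₂ wu∈) w) = trans (sym (label-∈ es wu∈)) (label-walk es w)

  ∣image∣≤1+∣image∘merge∣ : ∀ (f : Fin m → Fin m) a b →
                            ∣ image f ⊤ ∣ ≤ suc ∣ image (merge a b ∘ f) ⊤ ∣
  ∣image∣≤1+∣image∘merge∣ f a b = begin
    ∣ image f ⊤ ∣                               ≤⟨ p⊆q⇒∣p∣≤∣q∣ ⊆⁅a⁆∪image ⟩
    ∣ ⁅ a ⁆ ∪ image (merge a b ∘ f) ⊤ ∣          ≤⟨ ∣p∪q∣≤∣p∣+∣q∣ ⁅ a ⁆ _ ⟩
    ∣ ⁅ a ⁆ ∣ + ∣ image (merge a b ∘ f) ⊤ ∣      ≡⟨ cong (_+ ∣ image (merge a b ∘ f) ⊤ ∣) (∣⁅x⁆∣≡1 a) ⟩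
    suc ∣ image (merge a b ∘ f) ⊤ ∣              ∎
    where
    open ≤-Reasoning
    ⊆⁅a⁆∪image : image f ⊤ ⊆ ⁅ a ⁆ ∪ image (merge a b ∘ f) ⊤
    ⊆⁅a⁆∪image {y} y∈ with ∈image⁻ f ⊤ y∈ | y ≟ a
    ... | _ , _ , _    | yes refl = x∈p∪q⁺ (inj₁ (x∈⁅x⁆ a))
    ... | x , _ , refl | no  y≢a  =
      x∈p∪q⁺ (inj₂ (subst (_∈ _) (merge-≢ y≢a) (∈image⁺ (merge a b ∘ f) (∈⊤ {x = x}))))

  -- Each edge merges at most two label classes, so at least m − |es| labels survive.
  m≤∣labels∣+∣es∣ : ∀ es → m ≤ ∣ image (label es) ⊤ ∣ + length es
  m≤∣labels∣+∣es∣ [] = begin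
    m                          ≡⟨ ∣⊤∣≡n m ⟨
    ∣ ⊤ {m} ∣                  ≤⟨ p⊆q⇒∣p∣≤∣q∣ {p = ⊤ {m}} {q = image id (⊤ {m})} (λ {x} _ → ∈image⁺ id (∈⊤ {x = x})) ⟩
    ∣ image id (⊤ {m}) ∣       ≡⟨ +-identityʳ _ ⟨
    ∣ image id (⊤ {m}) ∣ + 0   ∎
    where open ≤-Reasoning
  m≤∣labels∣+∣es∣ ((a , b) ∷ es) = begin
    m                                              ≤⟨ m≤∣labels∣+∣es∣ es ⟩
    ∣ image (label es) ⊤ ∣ + length es            ≤⟨ +-monoˡ-≤ (length es) (∣image∣≤1+∣image∘merge∣ (label es) _ _) ⟩
    suc ∣ image (label ((a , b) ∷ es)) ⊤ ∣ + length es ≡⟨ +-suc _ (length es) ⟨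
    ∣ image (label ((a , b) ∷ es)) ⊤ ∣ + suc (length es) ∎
    where open ≤-Reasoning

  ∣p∣+∣∁p∣≡n : (p : Subset m) → ∣ p ∣ + ∣ ∁ p ∣ ≡ m
  ∣p∣+∣∁p∣≡n p = trans (sym (∣p∪q∣≡∣p∣+∣q∣ p (∁ p) x∈p⇒x∉∁p))
                      (trans (cong ∣_∣ (p∪∁p≡⊤ p)) (∣⊤∣≡n m))

  LinkConnected : Subset m → List (Fin m × Fin m) → Set
  LinkConnected V es = ∀ {u v} → u ∈ V → v ∈ V → Walk (Link es) u v

  ∣labels∣≤1+∣∁V∣ : ∀ (V : Subset m) es {v₀} → v₀ ∈ V → LinkConnected V es → ∣ image (label es) ⊤ ∣ ≤ suc ∣ ∁ V ∣
  ∣labels∣≤1+∣∁V∣ V es {v₀} v₀∈V conn = begin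
    ∣ image (label es) ⊤ ∣                                 ≤⟨ p⊆q⇒∣p∣≤∣q∣ labels⊆ ⟩
    ∣ ⁅ label es v₀ ⁆ ∪ image (label es) (∁ V) ∣           ≤⟨ ∣p∪q∣≤∣p∣+∣q∣ ⁅ label es v₀ ⁆ (image (label es) (∁ V)) ⟩
    ∣ ⁅ label es v₀ ⁆ ∣ + ∣ image (label es) (∁ V) ∣       ≡⟨ cong (_+ ∣ image (label es) (∁ V) ∣) (∣⁅x⁆∣≡1 (label es v₀)) ⟩
    suc ∣ image (label es) (∁ V) ∣                          ≤⟨ s≤s (∣image∣≤∣p∣ (label es) (∁ V)) ⟩
    suc ∣ ∁ V ∣                                             ∎
    where
    open ≤-Reasoning
    labels⊆ : image (label es) ⊤ ⊆ ⁅ label es v₀ ⁆ ∪ image (label es) (∁ V)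
    labels⊆ {y} y∈ with ∈image⁻ (label es) ⊤ y∈
    ... | x , _ , refl with x ∈? V
    ...   | yes x∈V = x∈p∪q⁺ (inj₁ (subst (_∈ ⁅ label es v₀ ⁆) (label-walk es (conn v₀∈V x∈V)) (x∈⁅x⁆ _)))
    ...   | no  x∉V = x∈p∪q⁺ (inj₂ (∈image⁺ (label es) (x∉p⇒x∈∁p x∉V)))

  connected⇒∣V∣≤1+∣es∣ : ∀ (V : Subset m) es → LinkConnected V es → ∣ V ∣ ≤ suc (length es)
  connected⇒∣V∣≤1+∣es∣ V es conn with nonempty? V
  ... | no  V=∅ = ≤-trans (≤-reflexive (trans (cong ∣_∣ (Empty-unique V=∅)) (∣⊥∣≡0 m))) z≤n
  ... | yes (v₀ , v₀∈V) = +-cancelˡ-≤ m _ _ (begin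
    m + ∣ V ∣                                      ≤⟨ +-monoˡ-≤ ∣ V ∣ (m≤∣labels∣+∣es∣ es) ⟩
    ∣ image (label es) ⊤ ∣ + length es + ∣ V ∣     ≤⟨ +-monoˡ-≤ ∣ V ∣ (+-monoˡ-≤ (length es) ∣labels∣≤) ⟩
    suc ∣ ∁ V ∣ + length es + ∣ V ∣                ≡⟨ rearrange (∣ ∁ V ∣) (length es) (∣ V ∣) ⟩
    (∣ V ∣ + ∣ ∁ V ∣) + suc (length es)            ≡⟨ cong (_+ suc (length es)) (∣p∣+∣∁p∣≡n V) ⟩
    m + suc (length es)                            ∎)
    where
    open ≤-Reasoning
    ∣labels∣≤ : ∣ image (label es) ⊤ ∣ ≤ suc ∣ ∁ V ∣
    ∣labels∣≤ = ∣labels∣≤1+∣∁V∣ V es v₀∈V conn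
    rearrange : ∀ a b c → suc a + b + c ≡ (c + a) + suc b
    rearrange = solve-∀

connected⇒∣vs∣≤1+nEdges : ∀ {X} (T : Subgraph X) → SubConnected T → ∣ vs T ∣ ≤ suc (nEdges T)
connected⇒∣vs∣≤1+nEdges T conn = connected⇒∣V∣≤1+∣es∣ (vs T) (es T) conn

module _ (X : Graph) where

  exitEdge : ∀ {W P u w} → u ∈ P → w ∉ P → Walk (InducedEdge X W) u w →
             ∃₂ λ x y → x ∈ P × y ∉ P × Edge X x y × y ∈ W
  exitEdge u∈P w∉P here = contradiction u∈P w∉P
  exitEdge {P = P} {u = u} u∈P w∉P (step {w = v} (e , v∈W) walk) with v ∈? P
  ... | yes v∈P = exitEdge v∈P w∉P walk
  ... | no  v∉P = u , v , u∈P , v∉P , e , v∈W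

  orient : ∀ {x y} → Edge X x y →
           Σ (Fin (n X) × Fin (n X)) λ (i , j) → toℕ i < toℕ j × Edge X i j × ((i , j) ≡ (x , y) ⊎ (i , j) ≡ (y , x))
  orient {x} {y} e with <-cmp (toℕ x) (toℕ y)
  ... | tri< x<y _ _ = (x , y) , x<y , e , inj₁ refl
  ... | tri≈ _ x≡y _ = contradiction (toℕ-injective x≡y) (Edge⇒≢ X e)
  ... | tri> _ _ y<x = (y , x) , y<x , Edge-sym X e , inj₂ refl

  record PartialTree (W : Subset (n X)) (w₀ : Fin (n X)) : Set where
    field
      tree         : Subgraph X
      tree⊆W       : vs tree ⊆ W
      w₀∈tree      : w₀ ∈ vs tree
      connected    : SubConnected tree
      edges<vertices : suc (nEdges tree) ≤ ∣ vs tree ∣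
  open PartialTree

  singletonTree : ∀ {W w₀} → w₀ ∈ W → PartialTree W w₀
  singletonTree {W} {w₀} w₀∈W = record
    { tree           = record { vs = ⁅ w₀ ⁆ ; es = [] ; es-unique = [] ; es-edges = λ () }
    ; tree⊆W         = λ x∈ → subst (_∈ W) (sym (x∈⁅y⁆⇒x≡y w₀ x∈)) w₀∈W
    ; w₀∈tree        = x∈⁅x⁆ w₀
    ; connected      = λ u∈ v∈ → subst₂ (Walk _) (sym (x∈⁅y⁆⇒x≡y w₀ u∈)) (sym (x∈⁅y⁆⇒x≡y w₀ v∈)) here
    ; edges<vertices = ≤-reflexive (sym (∣⁅x⁆∣≡1 w₀))
    }

  module _ (T : Subgraph X) {x y} (x∈ : x ∈ vs T) (y∉ : y ∉ vs T) (e : Edge X x y) where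

    private
      ij : Fin (n X) × Fin (n X)
      ij = proj₁ (orient e)

      i j : Fin (n X)
      i = proj₁ ij
      j = proj₂ ij

      ij≡ : ij ≡ (x , y) ⊎ ij ≡ (y , x)
      ij≡ = proj₂ (proj₂ (proj₂ (orient e)))

      old∈ : ∀ {z} → z ∈ vs T → z ∈ vs T ∪ ⁅ y ⁆
      old∈ z∈ = x∈p∪q⁺ (inj₁ z∈)

      y∈ : y ∈ vs T ∪ ⁅ y ⁆
      y∈ = x∈p∪q⁺ (inj₂ (x∈⁅x⁆ y))

      ij∈ : i ∈ vs T ∪ ⁅ y ⁆ × j ∈ vs T ∪ ⁅ y ⁆
      ij∈ = [ (λ eq → subst (_∈ _) (sym (cong proj₁ eq)) (old∈ x∈) , subst (_∈ _) (sym (cong proj₂ eq)) y∈)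
            , (λ eq → subst (_∈ _) (sym (cong proj₁ eq)) y∈ , subst (_∈ _) (sym (cong proj₂ eq)) (old∈ x∈))
            ]′ ij≡

      new : ∀ {p} → p ∈ₗ es T → ij ≢ p
      new p∈ refl with es-edges T p∈
      ... | _ , _ , i∈ , j∈ = [ (λ eq → y∉ (subst (_∈ vs T) (cong proj₂ eq) j∈))
                              , (λ eq → y∉ (subst (_∈ vs T) (cong proj₁ eq) i∈)) ]′ ij≡

    addLeaf : Subgraph X
    addLeaf = record
      { vs        = vs T ∪ ⁅ y ⁆
      ; es        = ij ∷ es T
      ; es-unique = tabulateᴬ new ∷ es-unique T
      ; es-edges  = λ { (here refl) → proj₁ (proj₂ (orient e)) , proj₁ (proj₂ (proj₂ (orient e))) , ij∈
                      ; (there p∈) → let a , b , c , d = es-edges T p∈ in a , b , old∈ c , old∈ d } }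

    addLeaf-connected : SubConnected T → SubConnected addLeaf
    addLeaf-connected conn u∈ v∈ = toX u∈ ++ᵂ fromX v∈
      where
      xy : SubEdge addLeaf x y × SubEdge addLeaf y x
      xy = [ (λ eq → inj₁ (here (sym eq)) , inj₂ (here (sym eq)))
           , (λ eq → inj₂ (here (sym eq)) , inj₁ (here (sym eq))) ]′ ij≡
      lift : ∀ {a b} → SubEdge T a b → SubEdge addLeaf a b
      lift = [ inj₁ ∘ there , inj₂ ∘ there ]′
      toX : ∀ {u} → u ∈ vs T ∪ ⁅ y ⁆ → Walk (SubEdge addLeaf) u x
      toX u∈ with x∈p∪⁅y⁆⁻ u∈
      ... | inj₁ u∈T = mapWalk lift (conn u∈T x∈)
      ... | inj₂ refl = step (proj₂ xy) here
      fromX : ∀ {u} → u ∈ vs T ∪ ⁅ y ⁆ → Walk (SubEdge addLeaf) x u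
      fromX u∈ with x∈p∪⁅y⁆⁻ u∈
      ... | inj₁ u∈T = mapWalk lift (conn x∈ u∈T)
      ... | inj₂ refl = step (proj₁ xy) here

  extendTree : ∀ {W w₀} (t : PartialTree W w₀) {x y} → x ∈ vs (tree t) → y ∉ vs (tree t) →
               Edge X x y → y ∈ W → Σ (PartialTree W w₀) λ t′ → ∣ vs (tree t′) ∣ ≡ suc ∣ vs (tree t) ∣
  extendTree {W} t {y = y} x∈ y∉ e y∈W = t′ , ∣p∪⁅x⁆∣≡1+∣p∣ y∉
    where
    t′ : PartialTree W _
    t′ = record
      { tree           = addLeaf (tree t) x∈ y∉ e
      ; tree⊆W         = λ u∈ → [ tree⊆W t , (λ { refl → y∈W }) ]′ (x∈p∪⁅y⁆⁻ u∈)
      ; w₀∈tree        = x∈p∪q⁺ (inj₁ (w₀∈tree t))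
      ; connected      = addLeaf-connected (tree t) x∈ y∉ e (connected t)
      ; edges<vertices = subst (suc (suc (nEdges (tree t))) ≤_) (sym (∣p∪⁅x⁆∣≡1+∣p∣ y∉)) (s≤s (edges<vertices t))
      }

  growTree : ∀ {W w₀} → InducedConnected X W → (fuel : ℕ) (t : PartialTree W w₀) →
             ∣ W ∣ ≤ ∣ vs (tree t) ∣ + fuel → Σ (PartialTree W w₀) λ t′ → vs (tree t′) ≡ W
  growTree {W} conn fuel t ∣W∣≤ with any? (λ w → w ∈? W ×-dec ¬? (w ∈? vs (tree t)))
  ... | no none = t , ⊆-antisym (tree⊆W t) W⊆tree
    where
    W⊆tree : W ⊆ vs (tree t)
    W⊆tree {w} w∈W with w ∈? vs (tree t)
    ... | yes w∈ = w∈
    ... | no  w∉ = contradiction (w , w∈W , w∉) none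
  ... | yes (w , w∈W , w∉) with exitEdge (w₀∈tree t) w∉ (conn (tree⊆W t (w₀∈tree t)) w∈W)
  ...   | x , y , x∈ , y∉ , e , y∈W with fuel | extendTree t x∈ y∉ e y∈W
  ...     | zero      | _ = contradiction (subst (w ∈_) (sym tree≡W) w∈W) w∉
    where
    tree≡W : vs (tree t) ≡ W
    tree≡W = p⊆q⇒∣q∣≤∣p∣⇒p≡q (tree⊆W t) (subst (∣ W ∣ ≤_) (+-identityʳ _) ∣W∣≤)
  ...     | suc fuel′ | t′ , grew =
    growTree conn fuel′ t′ (subst (∣ W ∣ ≤_) (trans (+-suc _ fuel′) (cong (_+ fuel′) (sym grew))) ∣W∣≤)

  spanningTree : ∀ {W w₀} → InducedConnected X W → w₀ ∈ W →
                 Σ (Subgraph X) λ T → vs T ≡ W × SubConnected T × suc (nEdges T) ≤ ∣ W ∣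
  spanningTree {W} conn w₀∈W with growTree conn ∣ W ∣ (singletonTree w₀∈W) (m≤n+m ∣ W ∣ _)
  ... | t , tree≡W =
    tree t , tree≡W , connected t , subst (suc (nEdges (tree t)) ≤_) (cong ∣_∣ tree≡W) (edges<vertices t)

module _ {X : Graph} {B : Subset (n X)} (T : Subgraph X) (st : SteinerTree X B T) where

  steinerTree-∣vs∣≤ : ∀ {W w} → B ⊆ W → InducedConnected X W → w ∈ W → ∣ vs T ∣ ≤ ∣ W ∣
  steinerTree-∣vs∣≤ {W} B⊆W conn w∈W with spanningTree X conn w∈W
  ... | T′ , T′≡W , T′-conn , T′-size = begin
    ∣ vs T ∣             ≤⟨ connected⇒∣vs∣≤1+nEdges T (proj₂ (proj₂ (proj₁ st))) ⟩
    suc (nEdges T)       ≤⟨ s≤s (proj₂ st T′ (⊆⊤ , (λ b∈B → subst (_ ∈_) (sym T′≡W) (B⊆W b∈B)) , T′-conn)) ⟩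
    suc (nEdges T′)      ≤⟨ T′-size ⟩
    ∣ W ∣                ∎
    where open ≤-Reasoning

  steinerTree-vs≡ : ∣ vs T ∣ ≤ ∣ B ∣ → vs T ≡ B
  steinerTree-vs≡ ∣vs∣≤∣B∣ = sym (p⊆q⇒∣q∣≤∣p∣⇒p≡q (proj₁ (proj₂ (proj₁ st))) ∣vs∣≤∣B∣)

  steinerTree-connected : ∀ {b} → InducedConnected X B → b ∈ B → vs T ≡ B
  steinerTree-connected conn b∈B = steinerTree-vs≡ (steinerTree-∣vs∣≤ (λ x∈ → x∈) conn b∈B)

module Lexicographic (G H : Graph) where

  N : ℕ
  N = n G * n H

  L : Graph
  L = lex G H

  π : Fin N → Fin (n G)
  π = quotient (n H)

  ρ : Fin N → Fin (n H)
  ρ = remainder {n G} (n H)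

  π-combine : ∀ g h → π (combine g h) ≡ g
  π-combine g h = cong proj₁ (remQuot-combine {n G} {n H} g h)

  ρ-combine : ∀ g h → ρ (combine g h) ≡ h
  ρ-combine g h = cong proj₂ (remQuot-combine {n G} {n H} g h)

  combine-πρ : ∀ x → combine (π x) (ρ x) ≡ x
  combine-πρ = combine-remQuot {n G} (n H)

  Edge-lexᴳ : ∀ {x y} → Edge G (π x) (π y) → Edge L x y
  Edge-lexᴳ e = cong (_∨ _) e

  Edge-lexᴴ : ∀ {x y} → π x ≡ π y → Edge H (ρ x) (ρ y) → Edge L x y
  Edge-lexᴴ {x} {y} πx≡πy e =
    trans (cong₂ (λ a b → adj G (π x) (π y) ∨ (a ∧ b)) πx=πy e) (∨-zeroʳ _)
    where
    πx=πy : ⌊ π x ≟ π y ⌋ ≡ true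
    πx=πy = trans (isYes≗does (π x ≟ π y)) (dec-true (π x ≟ π y) πx≡πy)

  Edge-lex⁻ : ∀ {x y} → Edge L x y → Edge G (π x) (π y) ⊎ (π x ≡ π y × Edge H (ρ x) (ρ y))
  Edge-lex⁻ {x} {y} e with adj G (π x) (π y) | π x ≟ π y | adj H (ρ x) (ρ y)
  ... | true  | _          | _    = inj₁ refl
  ... | false | yes πx≡πy  | true = inj₂ (πx≡πy , refl)

  fiber : Subset N → Fin (n G) → Subset (n H)
  fiber W g = ⟦ (λ h → combine g h ∈? W) ⟧

  ∈fiber⁺ : ∀ {W x} → x ∈ W → ρ x ∈ fiber W (π x)
  ∈fiber⁺ {W} {x} x∈W = ∈⟦⟧⁺ (λ h → combine (π x) h ∈? W) (subst (_∈ W) (sym (combine-πρ x)) x∈W)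

  ∈fiber⁻ : ∀ {W g h} → h ∈ fiber W g → combine g h ∈ W
  ∈fiber⁻ {W} {g} = ∈⟦⟧⁻ (λ h → combine g h ∈? W)

  fiber-mono : ∀ {V W g} → V ⊆ W → fiber V g ⊆ fiber W g
  fiber-mono {W = W} {g} V⊆W h∈ = ∈⟦⟧⁺ (λ h → combine g h ∈? W) (V⊆W (∈fiber⁻ h∈))

  OverVertex : Subset N → Fin (n G) → Set
  OverVertex W g = ∀ {x} → x ∈ W → π x ≡ g

  oneFiber : ∀ {W x} → ¬ 2 ≤ ∣ image π W ∣ → x ∈ W → OverVertex W (π x)
  oneFiber {x = x} 2≰∣πW∣ x∈W {y} y∈W with π y ≟ π x
  ... | yes πy≡πx = πy≡πx
  ... | no  πy≢πx = contradiction (∃≢⇒2≤∣p∣ (∈image⁺ π y∈W) (∈image⁺ π x∈W) πy≢πx) 2≰∣πW∣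

  module _ {W : Subset N} {g : Fin (n G)} (over : OverVertex W g) where

    ρ∈fiber : ∀ {x} → x ∈ W → ρ x ∈ fiber W g
    ρ∈fiber x∈W = subst (λ g′ → ρ _ ∈ fiber W g′) (over x∈W) (∈fiber⁺ x∈W)

    ∣W∣≡∣fiber∣ : ∣ W ∣ ≡ ∣ fiber W g ∣
    ∣W∣≡∣fiber∣ = begin
      ∣ W ∣                         ≡⟨ cong ∣_∣ W≡⁅g⁆⊠fiber ⟩
      ∣ ⁅ g ⁆ ⊠ fiber W g ∣         ≡⟨ ∣p⊠q∣≡∣p∣*∣q∣ ⁅ g ⁆ (fiber W g) ⟩
      ∣ ⁅ g ⁆ ∣ * ∣ fiber W g ∣     ≡⟨ cong (_* ∣ fiber W g ∣) (∣⁅x⁆∣≡1 g) ⟩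
      ∣ fiber W g ∣ + 0             ≡⟨ +-identityʳ _ ⟩
      ∣ fiber W g ∣                 ∎
      where
      open ≡-Reasoning
      W≡⁅g⁆⊠fiber : W ≡ ⁅ g ⁆ ⊠ fiber W g
      W≡⁅g⁆⊠fiber = ⊆-antisym
        (λ x∈W → ∈⊠⁺ (subst (_∈ ⁅ g ⁆) (sym (over x∈W)) (x∈⁅x⁆ g)) (ρ∈fiber x∈W))
        (λ {x} x∈ → let πx∈⁅g⁆ , ρx∈fiber = ∈⊠⁻ x∈
                    in subst (_∈ W) (trans (cong (λ g′ → combine g′ (ρ x)) (sym (x∈⁅y⁆⇒x≡y g πx∈⁅g⁆))) (combine-πρ x))
                         (∈fiber⁻ ρx∈fiber))

    fiberWalk⁺ : ∀ {h h′} → Walk (InducedEdge H (fiber W g)) h h′ → Walk (InducedEdge L W) (combine g h) (combine g h′)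
    fiberWalk⁺ here = here
    fiberWalk⁺ {h} (step {w = h₁} (e , h₁∈) walk) =
      step (Edge-lexᴴ (trans (π-combine g h) (sym (π-combine g h₁)))
                      (subst₂ (Edge H) (sym (ρ-combine g h)) (sym (ρ-combine g h₁)) e)
           , ∈fiber⁻ h₁∈)
           (fiberWalk⁺ walk)

    fiberWalk⁻ : ∀ {x y} → π x ≡ g → Walk (InducedEdge L W) x y → Walk (InducedEdge H (fiber W g)) (ρ x) (ρ y)
    fiberWalk⁻ πx≡g here = here
    fiberWalk⁻ πx≡g (step {w = z} (e , z∈W) walk) with Edge-lex⁻ e
    ... | inj₁ eᴳ      = contradiction (trans πx≡g (sym (over z∈W))) (Edge⇒≢ G eᴳ)
    ... | inj₂ (_ , eᴴ) = step (eᴴ , ρ∈fiber z∈W) (fiberWalk⁻ (over z∈W) walk)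

    fiber-connected⁺ : InducedConnected H (fiber W g) → InducedConnected L W
    fiber-connected⁺ conn {x} {y} x∈W y∈W =
      subst₂ (Walk (InducedEdge L W)) (back x∈W) (back y∈W) (fiberWalk⁺ (conn (ρ∈fiber x∈W) (ρ∈fiber y∈W)))
      where
      back : ∀ {z} → z ∈ W → combine g (ρ z) ≡ z
      back {z} z∈W = trans (cong (λ g′ → combine g′ (ρ z)) (sym (over z∈W))) (combine-πρ z)

    fiber-connected⁻ : InducedConnected L W → InducedConnected H (fiber W g)
    fiber-connected⁻ conn {h} {h′} h∈ h′∈ =
      subst₂ (Walk (InducedEdge H (fiber W g))) (ρ-combine g h) (ρ-combine g h′)
        (fiberWalk⁻ (π-combine g h) (conn (∈fiber⁻ h∈) (∈fiber⁻ h′∈)))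

  projectWalk : ∀ {Q x y} → Walk (InducedEdge L Q) x y → Walk (InducedEdge G (image π Q)) (π x) (π y)
  projectWalk here = here
  projectWalk (step (e , z∈Q) walk) with Edge-lex⁻ e
  ... | inj₁ eᴳ           = step (eᴳ , ∈image⁺ π z∈Q) (projectWalk walk)
  ... | inj₂ (πx≡πz , _)  = subst (λ g → Walk _ g _) (sym πx≡πz) (projectWalk walk)

  project-connected : ∀ {Q} → InducedConnected L Q → InducedConnected G (image π Q)
  project-connected {Q} conn g∈ g′∈ with ∈image⁻ π Q g∈ | ∈image⁻ π Q g′∈
  ... | x , x∈Q , refl | y , y∈Q , refl = projectWalk (conn x∈Q y∈Q)

  completion : Subset N → Subset (n G) → Fin (n H) → Subset N
  completion B U h₀ = B ∪ (U ─ image π B) ⊠ ⁅ h₀ ⁆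

  module _ {B : Subset N} {U : Subset (n G)} (πB⊆U : image π B ⊆ U) (h₀ : Fin (n H)) where

    private
      R : Subset N
      R = (U ─ image π B) ⊠ ⁅ h₀ ⁆

      over-U─πB : ∀ {x} → x ∈ R → π x ∈ U × π x ∉ image π B
      over-U─πB x∈R = x∈p─q⁻ (proj₁ (∈⊠⁻ {p = U ─ image π B} {q = ⁅ h₀ ⁆} x∈R))

    ∣completion∣ : ∣ completion B U h₀ ∣ + ∣ image π B ∣ ≡ ∣ B ∣ + ∣ U ∣
    ∣completion∣ = begin
      ∣ B ∪ R ∣ + t                              ≡⟨ cong (_+ t) (∣p∪q∣≡∣p∣+∣q∣ B R B∩R=∅) ⟩
      ∣ B ∣ + ∣ R ∣ + t                          ≡⟨ cong (λ r → ∣ B ∣ + r + t) ∣R∣≡∣U─πB∣ ⟩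
      ∣ B ∣ + ∣ U ─ image π B ∣ + t              ≡⟨ +-assoc ∣ B ∣ _ t ⟩
      ∣ B ∣ + (∣ U ─ image π B ∣ + t)            ≡⟨ cong (∣ B ∣ +_) (trans (+-comm _ t) (sym (q⊆p⇒∣p∣≡∣q∣+∣p─q∣ πB⊆U))) ⟩
      ∣ B ∣ + ∣ U ∣                              ∎
      where
      open ≡-Reasoning
      t : ℕ
      t = ∣ image π B ∣
      B∩R=∅ : Disjoint B R
      B∩R=∅ x∈B x∈R = proj₂ (over-U─πB x∈R) (∈image⁺ π x∈B)
      ∣R∣≡∣U─πB∣ : ∣ R ∣ ≡ ∣ U ─ image π B ∣
      ∣R∣≡∣U─πB∣ = trans (∣p⊠q∣≡∣p∣*∣q∣ (U ─ image π B) ⁅ h₀ ⁆)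
                         (trans (cong (∣ U ─ image π B ∣ *_) (∣⁅x⁆∣≡1 h₀)) (*-identityʳ _))

    image-completion : image π (completion B U h₀) ≡ U
    image-completion = ⊆-antisym image⊆U U⊆image
      where
      image⊆U : image π (completion B U h₀) ⊆ U
      image⊆U g∈ with ∈image⁻ π (completion B U h₀) g∈
      ... | x , x∈ , refl = [ (λ x∈B → πB⊆U (∈image⁺ π x∈B)) , proj₁ ∘ over-U─πB ]′ (x∈p∪q⁻ B R x∈)
      U⊆image : U ⊆ image π (completion B U h₀)
      U⊆image {g} g∈U with g ∈? image π B
      ... | yes g∈πB = let x , x∈B , πx≡g = ∈image⁻ π B g∈πB
                       in subst (_∈ image π _) πx≡g (∈image⁺ π (x∈p∪q⁺ (inj₁ x∈B)))
      ... | no  g∉πB = subst (_∈ image π _) (π-combine g h₀)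
                         (∈image⁺ π (x∈p∪q⁺ (inj₂ (combine∈⊠⁺ (x∈p∧x∉q⇒x∈p─q g∈U g∉πB) (x∈⁅x⁆ h₀)))))

  -- A walk in G through the projection lifts vertex by vertex to W; a walk of length
  -- zero is first replaced by a detour to a neighbour and back.
  module _ {W : Subset N} (conn : InducedConnected G (image π W)) (2≤∣πW∣ : 2 ≤ ∣ image π W ∣) where

    liftWalk : ∀ {g g₁ g′ x y} → InducedEdge G (image π W) g g₁ → Walk (InducedEdge G (image π W)) g₁ g′ →
               π x ≡ g → π y ≡ g′ → y ∈ W → Walk (InducedEdge L W) x y
    liftWalk (e , _) here refl refl y∈W = step (Edge-lexᴳ e , y∈W) here
    liftWalk (e , g₁∈) (step e′ walk) refl πy≡g′ y∈W with ∈image⁻ π W g₁∈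
    ... | r , r∈W , refl = step (Edge-lexᴳ e , r∈W) (liftWalk e′ walk refl πy≡g′ y∈W)

    lift-connected : InducedConnected L W
    lift-connected x∈W y∈W = lift (conn (∈image⁺ π x∈W) (∈image⁺ π y∈W)) refl refl x∈W y∈W
      where
      lift : ∀ {g g′ x y} → Walk (InducedEdge G (image π W)) g g′ → π x ≡ g → π y ≡ g′ →
             x ∈ W → y ∈ W → Walk (InducedEdge L W) x y
      lift (step e walk) πx≡g πy≡g′ _ y∈W = liftWalk e walk πx≡g πy≡g′ y∈W
      lift here refl πy≡g x∈W y∈W with neighbourIn G conn 2≤∣πW∣ (∈image⁺ π x∈W)
      ... | _ , e , g′∈ = liftWalk (e , g′∈) (step (Edge-sym G e , ∈image⁺ π x∈W) here) refl πy≡g y∈W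

module SteinerProjection (G H : Graph) where

  open Lexicographic G H

  module _ {B : Subset N} (T : Subgraph L) (st : SteinerTree L B T) (2≤t : 2 ≤ ∣ image π B ∣) where

    private
      Q : Subset N
      Q = vs T

      P B′ : Subset (n G)
      P = image π Q
      B′ = image π B

      t k : ℕ
      t = ∣ B′ ∣
      k = ∣ B ∣

      B⊆Q : B ⊆ Q
      B⊆Q = proj₁ (proj₂ (proj₁ st))

      B′⊆P : B′ ⊆ P
      B′⊆P g∈ with ∈image⁻ π B g∈
      ... | x , x∈B , refl = ∈image⁺ π (B⊆Q x∈B)

      element : ∃ (_∈ B)
      element with 2≤∣p∣⇒∃≢ 2≤t
      ... | g , _ , g∈B′ , _ with ∈image⁻ π B g∈B′
      ...   | b , b∈B , _ = b , b∈B

      b₀ : Fin N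
      b₀ = proj₁ element

      h₀ : Fin (n H)
      h₀ = ρ b₀

      B⊆B′⊠⊤ : B ⊆ B′ ⊠ ⊤
      B⊆B′⊠⊤ x∈B = ∈⊠⁺ (∈image⁺ π x∈B) ∈⊤

    -- completion B U h₀ is connected (it projects onto U) and has k + |U| − t vertices.
    ∣Q∣+t≤k+∣U∣ : ∀ {U} → B′ ⊆ U → InducedConnected G U → ∣ Q ∣ + t ≤ k + ∣ U ∣
    ∣Q∣+t≤k+∣U∣ {U} B′⊆U U-conn = begin
      ∣ Q ∣ + t                ≤⟨ +-monoˡ-≤ t (steinerTree-∣vs∣≤ T st B⊆W W-conn (B⊆W (proj₂ element))) ⟩
      ∣ W ∣ + t                ≡⟨ ∣completion∣ B′⊆U h₀ ⟩
      k + ∣ U ∣                ∎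
      where
      open ≤-Reasoning
      W : Subset N
      W = completion B U h₀
      B⊆W : B ⊆ W
      B⊆W = p⊆p∪q _
      πW≡U : image π W ≡ U
      πW≡U = image-completion B′⊆U h₀
      W-conn : InducedConnected L W
      W-conn = lift-connected (subst (InducedConnected G) (sym πW≡U) U-conn)
                              (subst (λ V → 2 ≤ ∣ V ∣) (sym πW≡U) (≤-trans 2≤t (p⊆q⇒∣p∣≤∣q∣ B′⊆U)))

    ∣C∣+∣P∣≤∣Q∣+t : ∀ {C} → C ⊆ Q → C ⊆ B′ ⊠ ⊤ → ∣ C ∣ + ∣ P ∣ ≤ ∣ Q ∣ + t
    ∣C∣+∣P∣≤∣Q∣+t {C} C⊆Q C⊆X = begin
      ∣ C ∣ + ∣ P ∣                           ≡⟨ cong (∣ C ∣ +_) (q⊆p⇒∣p∣≡∣q∣+∣p─q∣ B′⊆P) ⟩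
      ∣ C ∣ + (t + ∣ P ─ B′ ∣)                 ≤⟨ +-mono-≤ (p⊆q⇒∣p∣≤∣q∣ C⊆Q∩X) (+-monoʳ-≤ t ∣P─B′∣≤∣Q─X∣) ⟩
      ∣ Q ∩ X ∣ + (t + ∣ Q ─ X ∣)              ≡⟨ swap-middle (∣ Q ∩ X ∣) t (∣ Q ─ X ∣) ⟩
      (∣ Q ∩ X ∣ + ∣ Q ─ X ∣) + t              ≡⟨ cong (_+ t) (∣p∣≡∣p∩q∣+∣p─q∣ Q X) ⟨
      ∣ Q ∣ + t                               ∎
      where
      open ≤-Reasoning
      X : Subset N
      X = B′ ⊠ ⊤
      C⊆Q∩X : C ⊆ Q ∩ X
      C⊆Q∩X x∈C = x∈p∩q⁺ (C⊆Q x∈C , C⊆X x∈C)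
      ∣P─B′∣≤∣Q─X∣ : ∣ P ─ B′ ∣ ≤ ∣ Q ─ X ∣
      ∣P─B′∣≤∣Q─X∣ = ≤-trans (p⊆q⇒∣p∣≤∣q∣ P─B′⊆π[Q─X]) (∣image∣≤∣p∣ π (Q ─ X))
        where
        P─B′⊆π[Q─X] : P ─ B′ ⊆ image π (Q ─ X)
        P─B′⊆π[Q─X] g∈ with x∈p─q⁻ g∈
        ... | g∈P , g∉B′ with ∈image⁻ π Q g∈P
        ...   | x , x∈Q , refl = ∈image⁺ π (x∈p∧x∉q⇒x∈p─q x∈Q (λ x∈X → g∉B′ (proj₁ (∈⊠⁻ {p = B′} {q = ⊤} x∈X))))
      swap-middle : ∀ a b c → a + (b + c) ≡ (a + c) + b
      swap-middle = solve-∀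

    private
      P-conn : InducedConnected G P
      P-conn = project-connected (SubConnected⇒InducedConnected L T (proj₂ (proj₂ (proj₁ st))))

      spanning : Σ (Subgraph G) λ T′ → vs T′ ≡ P × SubConnected T′ × suc (nEdges T′) ≤ ∣ P ∣
      spanning = spanningTree G P-conn (B′⊆P (∈image⁺ π (proj₂ element)))

    projectionTree : Subgraph G
    projectionTree = proj₁ spanning

    projectionTree-vs : vs projectionTree ≡ P
    projectionTree-vs = proj₁ (proj₂ spanning)

    -- Comparing the two bounds shows that no connected subgraph containing π(B) is smaller than π(Q).
    projectionTree-steiner : SteinerTree G B′ projectionTree
    projectionTree-steiner =
      (⊆⊤ , (λ g∈ → subst (_ ∈_) (sym projectionTree-vs) (B′⊆P g∈)) , proj₁ (proj₂ (proj₂ spanning))) , minimal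
      where
      minimal : ∀ T″ → ConnSubIn G ⊤ B′ T″ → nEdges projectionTree ≤ nEdges T″
      minimal T″ (_ , B′⊆T″ , T″-conn) = s≤s⁻¹ (begin
        suc (nEdges projectionTree)   ≤⟨ proj₂ (proj₂ (proj₂ spanning)) ⟩
        ∣ P ∣                         ≤⟨ +-cancelˡ-≤ k _ _ (≤-trans (∣C∣+∣P∣≤∣Q∣+t B⊆Q B⊆B′⊠⊤)
                                           (∣Q∣+t≤k+∣U∣ B′⊆T″ (SubConnected⇒InducedConnected G T″ T″-conn))) ⟩
        ∣ vs T″ ∣                     ≤⟨ connected⇒∣vs∣≤1+nEdges T″ T″-conn ⟩
        suc (nEdges T″)               ∎)
        where open ≤-Reasoning

    module _ {S A} (sgp : SGP G t S) (A⊆S⊠⊤ : A ⊆ S ⊠ ⊤) (B⊆A : B ⊆ A) where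

      private
        P∩S≡B′ : P ∩ S ≡ B′
        P∩S≡B′ = subst (λ V → V ∩ S ≡ B′) projectionTree-vs (sgp B′ B′⊆S refl projectionTree projectionTree-steiner)
          where
          B′⊆S : B′ ⊆ S
          B′⊆S g∈ with ∈image⁻ π B g∈
          ... | x , x∈B , refl = proj₁ (∈⊠⁻ {p = S} {q = ⊤} (A⊆S⊠⊤ (B⊆A x∈B)))

      -- A further vertex x ∈ Q ∩ A projects into P ∩ S = π(B), which the lower bound forbids.
      noExtraVertex : ∀ {x} → x ∈ Q → x ∈ A → x ∉ B → Data.Empty.⊥
      noExtraVertex {x} x∈Q x∈A x∉B = <⇒≱ (begin-strict
        k + ∣ P ∣                  <⟨ ≤-refl ⟩
        suc k + ∣ P ∣              ≡⟨ cong (_+ ∣ P ∣) (∣p∪⁅x⁆∣≡1+∣p∣ x∉B) ⟨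
        ∣ B ∪ ⁅ x ⁆ ∣ + ∣ P ∣      ≤⟨ ∣C∣+∣P∣≤∣Q∣+t B∪x⊆Q B∪x⊆B′⊠⊤ ⟩
        ∣ Q ∣ + t                  ∎) (∣Q∣+t≤k+∣U∣ B′⊆P P-conn)
        where
        open ≤-Reasoning
        πx∈B′ : π x ∈ B′
        πx∈B′ = subst (π x ∈_) P∩S≡B′ (x∈p∩q⁺ (∈image⁺ π x∈Q , proj₁ (∈⊠⁻ {p = S} {q = ⊤} (A⊆S⊠⊤ x∈A))))
        B∪x⊆Q : B ∪ ⁅ x ⁆ ⊆ Q
        B∪x⊆Q y∈ = [ B⊆Q , (λ { refl → x∈Q }) ]′ (x∈p∪⁅y⁆⁻ y∈)
        B∪x⊆B′⊠⊤ : B ∪ ⁅ x ⁆ ⊆ B′ ⊠ ⊤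
        B∪x⊆B′⊠⊤ y∈ = [ B⊆B′⊠⊤ , (λ { refl → ∈⊠⁺ πx∈B′ ∈⊤ }) ]′ (x∈p∪⁅y⁆⁻ y∈)

      steinerTree∩A≡B : Q ∩ A ≡ B
      steinerTree∩A≡B = ⊆-antisym Q∩A⊆B (λ x∈B → x∈p∩q⁺ (B⊆Q x∈B , B⊆A x∈B))
        where
        Q∩A⊆B : Q ∩ A ⊆ B
        Q∩A⊆B {x} x∈ = let x∈Q , x∈A = x∈p∩q⁻ Q A x∈ in decidable-stable (x ∈? B) (noExtraVertex x∈Q x∈A)

ceilDiv≤ : ∀ k t d → k ≤ t * d → ceilDiv k d ≤ t
ceilDiv≤ k t zero    _ = z≤n
ceilDiv≤ k t (suc d) k≤td = s≤s⁻¹ (m<n*o⇒m/o<n {k + d} {suc t} {suc d} (begin-strict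
  k + d               ≤⟨ +-monoˡ-≤ d k≤td ⟩
  t * suc d + d       <⟨ +-monoʳ-< (t * suc d) (n<1+n d) ⟩
  t * suc d + suc d   ≡⟨ +-comm (t * suc d) (suc d) ⟩
  suc t * suc d       ∎))
  where open ≤-Reasoning

≤ceilDiv : ∀ k a d → 1 ≤ d → (a ∸ 1) * d < k → a ≤ ceilDiv k d
≤ceilDiv k zero    d       _ _ = z≤n
≤ceilDiv k (suc a) (suc d) _ ad<k = begin
  suc a                     ≡⟨ m*n/n≡m (suc a) (suc d) ⟨
  suc a * suc d / suc d     ≤⟨ /-monoˡ-≤ (suc d) (begin
                                 suc d + a * suc d   ≡⟨ +-comm (suc d) (a * suc d) ⟩
                                 a * suc d + suc d   ≡⟨ +-suc (a * suc d) d ⟩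
                                 suc (a * suc d) + d ≤⟨ +-monoˡ-≤ d ad<k ⟩
                                 k + d               ∎) ⟩
  (k + d) / suc d           ∎
  where open ≤-Reasoning

anyB≡false⇒ : ∀ {m} (f : Fin m → Bool) → anyB f ≡ false → ∀ i → f i ≡ false
anyB≡false⇒ f any≡false zero    = ∨-conicalˡ _ _ any≡false
anyB≡false⇒ f any≡false (suc i) = anyB≡false⇒ (f ∘ suc) (∨-conicalʳ _ _ any≡false) i

module _ (X : Graph) (S : Subset (n X)) where

  ∈isolated⁻ : ∀ {v} → v ∈ isolated X S → v ∈ S × (∀ {u} → u ∈ S → ¬ Edge X u v)
  ∈isolated⁻ {v} v∈ = lookup⇒∈ (∧-conicalˡ _ _ v-isolated) , no-edge
    where
    v-isolated : lookup S v ∧ not (anyB λ u → lookup S u ∧ adj X u v) ≡ true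
    v-isolated = trans (sym (lookup∘tabulate _ v)) (∈⇒lookup v∈)
    not-true : ∀ {b} → not b ≡ true → b ≡ false
    not-true {false} _ = refl
    no-edge : ∀ {u} → u ∈ S → ¬ Edge X u v
    no-edge {u} u∈S e with trans (sym (cong₂ _∧_ (∈⇒lookup u∈S) e))
                             (anyB≡false⇒ (λ u → lookup S u ∧ adj X u v) (not-true (∧-conicalʳ _ _ v-isolated)) u)
    ... | ()

  isolated⊆S : isolated X S ⊆ S
  isolated⊆S = proj₁ ∘ ∈isolated⁻

  nonIsolated⊆S : nonIsolated X S ⊆ S
  nonIsolated⊆S = proj₁ ∘ x∈p─q⁻

  isolated∩nonIsolated=∅ : Disjoint (isolated X S) (nonIsolated X S)
  isolated∩nonIsolated=∅ v∈I v∈J = proj₂ (x∈p─q⁻ v∈J) v∈I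

IsMaxSize-⊤ : ∀ {m} {P : Subset m → Set} {s} → IsMaxSize P s → P ⊤ → s ≡ m
IsMaxSize-⊤ {m} ((A , _ , ∣A∣≡s) , maximal) P⊤ =
  ≤-antisym (subst (_≤ m) ∣A∣≡s (∣p∣≤n A)) (subst (_≤ _) (∣⊤∣≡n m) (maximal ⊤ P⊤))

module LexicographicSGP (G H : Graph) where

  open Lexicographic G H
  open SteinerProjection G H

  ∣B∣≤∣πB∣*nH : ∀ B → ∣ B ∣ ≤ ∣ image π B ∣ * n H
  ∣B∣≤∣πB∣*nH B = begin
    ∣ B ∣                            ≤⟨ p⊆q⇒∣p∣≤∣q∣ (λ x∈B → ∈⊠⁺ (∈image⁺ π x∈B) ∈⊤) ⟩
    ∣ image π B ⊠ ⊤ ∣                ≡⟨ ∣p⊠q∣≡∣p∣*∣q∣ (image π B) ⊤ ⟩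
    ∣ image π B ∣ * ∣ ⊤ {n H} ∣      ≡⟨ cong (∣ image π B ∣ *_) (∣⊤∣≡n (n H)) ⟩
    ∣ image π B ∣ * n H              ∎
    where open ≤-Reasoning

  preimage-sgp : ∀ {k S} → n H < k → SGPRange G (ceilDiv k (n H)) (k ⊓ n G) S → SGP L k (S ⊠ ⊤)
  preimage-sgp {k} {S} nH<k range B B⊆S⊠⊤ ∣B∣≡k T st =
    steinerTree∩A≡B T st 2≤t (range t (ceilDiv≤ k t (n H) k≤t*nH) (⊓-glb t≤k (∣p∣≤n (image π B)))) (λ x∈ → x∈) B⊆S⊠⊤
    where
    t : ℕ
    t = ∣ image π B ∣
    k≤t*nH : k ≤ t * n H
    k≤t*nH = subst (_≤ t * n H) ∣B∣≡k (∣B∣≤∣πB∣*nH B)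
    t≤k : t ≤ k
    t≤k = subst (t ≤_) ∣B∣≡k (∣image∣≤∣p∣ π B)
    2≤t : 2 ≤ t
    2≤t = decidable-stable (2 ≤? t) λ 2≰t →
      <⇒≱ nH<k (≤-trans k≤t*nH (≤-trans (*-monoˡ-≤ (n H) (s≤s⁻¹ (≰⇒> 2≰t))) (≤-reflexive (*-identityˡ (n H)))))

  module _ {k : ℕ} (k-large : (n G ∸ 1) * n H < k) where

    ⊤-sgpRange : 2 ≤ n H → SGPRange G (ceilDiv k (n H)) (k ⊓ n G) ⊤
    ⊤-sgpRange 2≤nH t j≤t t≤ℓ B _ ∣B∣≡t T st = begin
      vs T ∩ ⊤      ≡⟨ ∩-identityʳ (vs T) ⟩
      vs T          ≡⟨ ⊆-antisym ⊆⊤ (λ {x} _ → proj₁ (proj₂ (proj₁ st)) (subst (x ∈_) (sym B≡⊤) ∈⊤)) ⟩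
      ⊤             ≡⟨ B≡⊤ ⟨
      B             ∎
      where
      open ≡-Reasoning
      t≡nG : t ≡ n G
      t≡nG = ≤-antisym (≤-trans t≤ℓ (m⊓n≤n k (n G))) (≤-trans (≤ceilDiv k (n G) (n H) (≤-trans (s≤s z≤n) 2≤nH) k-large) j≤t)
      B≡⊤ : B ≡ ⊤
      B≡⊤ = ∣p∣≡n⇒p≡⊤ (trans ∣B∣≡t t≡nG)

    -- A k-set that misses the fibre over g lies in (V(G) ∖ {g}) × V(H), which has fewer than k vertices.
    meets-every-fiber : ∀ {B} → ∣ B ∣ ≡ k → image π B ≡ ⊤
    meets-every-fiber {B} ∣B∣≡k = ⊆-antisym ⊆⊤ λ {g} _ → meets g
      where
      meets : ∀ g → g ∈ image π B
      meets g with g ∈? image π B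
      ... | yes g∈ = g∈
      ... | no  g∉ = contradiction (begin
        k                                ≡⟨ ∣B∣≡k ⟨
        ∣ B ∣                            ≤⟨ p⊆q⇒∣p∣≤∣q∣ B⊆ ⟩
        ∣ ∁ ⁅ g ⁆ ⊠ ⊤ ∣                  ≡⟨ ∣p⊠q∣≡∣p∣*∣q∣ (∁ ⁅ g ⁆) ⊤ ⟩
        ∣ ∁ ⁅ g ⁆ ∣ * ∣ ⊤ {n H} ∣        ≡⟨ cong₂ _*_ (trans (∣∁p∣≡n∸∣p∣ ⁅ g ⁆) (cong (n G ∸_) (∣⁅x⁆∣≡1 g))) (∣⊤∣≡n (n H)) ⟩
        (n G ∸ 1) * n H                  ∎) (<⇒≱ k-large)
        where
        open ≤-Reasoning
        B⊆ : B ⊆ ∁ ⁅ g ⁆ ⊠ ⊤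
        B⊆ x∈B = ∈⊠⁺ (x∉p⇒x∈∁p λ πx∈⁅g⁆ → g∉ (subst (_∈ image π B) (x∈⁅y⁆⇒x≡y g πx∈⁅g⁆) (∈image⁺ π x∈B))) ∈⊤

    ⊤-sgp : Connected G → Nontrivial G → SGP L k ⊤
    ⊤-sgp conn 2≤nG B _ ∣B∣≡k T st =
      trans (∩-identityʳ (vs T)) (steinerTree-connected T st B-conn (proj₂ (1≤∣p∣⇒Nonempty 1≤∣B∣)))
      where
      πB≡⊤ : image π B ≡ ⊤
      πB≡⊤ = meets-every-fiber ∣B∣≡k
      B-conn : InducedConnected L B
      B-conn = lift-connected (subst (InducedConnected G) (sym πB≡⊤) (Connected⇒InducedConnected⊤ G conn))
                              (subst (λ V → 2 ≤ ∣ V ∣) (sym πB≡⊤) (subst (2 ≤_) (sym (∣⊤∣≡n (n G))) 2≤nG))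
      1≤∣B∣ : 1 ≤ ∣ B ∣
      1≤∣B∣ = subst (1 ≤_) (sym ∣B∣≡k) (≤-trans (s≤s z≤n) k-large)

  module _ (S : Subset (n G)) (A₀ C₀ : Subset (n H)) where

    private
      I J : Subset (n G)
      I = isolated G S
      J = nonIsolated G S

    A : Subset N
    A = I ⊠ A₀ ∪ J ⊠ C₀

    ∣A∣≡∣I∣*∣A₀∣+∣J∣*∣C₀∣ : ∣ A ∣ ≡ ∣ I ∣ * ∣ A₀ ∣ + ∣ J ∣ * ∣ C₀ ∣
    ∣A∣≡∣I∣*∣A₀∣+∣J∣*∣C₀∣ = trans (∣p∪q∣≡∣p∣+∣q∣ (I ⊠ A₀) (J ⊠ C₀) disjoint)
                 (cong₂ _+_ (∣p⊠q∣≡∣p∣*∣q∣ I A₀) (∣p⊠q∣≡∣p∣*∣q∣ J C₀))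
      where
      disjoint : Disjoint (I ⊠ A₀) (J ⊠ C₀)
      disjoint x∈I⊠A₀ x∈J⊠C₀ =
        isolated∩nonIsolated=∅ G S (proj₁ (∈⊠⁻ {p = I} {q = A₀} x∈I⊠A₀)) (proj₁ (∈⊠⁻ {p = J} {q = C₀} x∈J⊠C₀))

    A⊆S⊠⊤ : A ⊆ S ⊠ ⊤
    A⊆S⊠⊤ x∈A = ∈⊠⁺ ([ isolated⊆S G S ∘ proj₁ ∘ ∈⊠⁻ {p = I} {q = A₀}
                     , nonIsolated⊆S G S ∘ proj₁ ∘ ∈⊠⁻ {p = J} {q = C₀} ]′ (x∈p∪q⁻ (I ⊠ A₀) (J ⊠ C₀) x∈A)) ∈⊤

    fiberA⊆A₀ : ∀ {g} → g ∈ I → fiber A g ⊆ A₀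
    fiberA⊆A₀ g∈I h∈ with x∈p∪q⁻ (I ⊠ A₀) (J ⊠ C₀) (∈fiber⁻ h∈)
    ... | inj₁ gh∈ = proj₂ (combine∈⊠⁻ {p = I} {q = A₀} gh∈)
    ... | inj₂ gh∈ = contradiction (proj₁ (combine∈⊠⁻ {p = J} {q = C₀} gh∈)) (isolated∩nonIsolated=∅ G S g∈I)

    fiberA⊆C₀ : ∀ {g} → g ∈ J → fiber A g ⊆ C₀
    fiberA⊆C₀ g∈J h∈ with x∈p∪q⁻ (I ⊠ A₀) (J ⊠ C₀) (∈fiber⁻ h∈)
    ... | inj₁ gh∈ = contradiction g∈J (isolated∩nonIsolated=∅ G S (proj₁ (combine∈⊠⁻ {p = I} {q = A₀} gh∈)))
    ... | inj₂ gh∈ = proj₂ (combine∈⊠⁻ {p = J} {q = C₀} gh∈)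

    module _ {k : ℕ} {B : Subset N} (B⊆A : B ⊆ A) (∣B∣≡k : ∣ B ∣ ≡ k)
             {g : Fin (n G)} (over : OverVertex B g) {b₀ : Fin N} (b₀∈B : b₀ ∈ B)
             (T : Subgraph L) (st : SteinerTree L B T) where

      private
        Q : Subset N
        Q = vs T
        B⊆Q : B ⊆ Q
        B⊆Q = proj₁ (proj₂ (proj₁ st))
        T-conn : SubConnected T
        T-conn = proj₂ (proj₂ (proj₁ st))
        ∣fiberB∣≡k : ∣ fiber B g ∣ ≡ k
        ∣fiberB∣≡k = trans (sym (∣W∣≡∣fiber∣ over)) ∣B∣≡k

      nonIsolatedFiber : SteinerClique H k C₀ → g ∈ J → Q ≡ B
      nonIsolatedFiber clique g∈J = steinerTree-connected T st
        (fiber-connected⁺ over (clique (fiber B g) (⊆-trans (fiber-mono B⊆A) (fiberA⊆C₀ g∈J)) ∣fiberB∣≡k)) b₀∈B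

      -- A vertex of T outside B would make d_{H[A₀]}(fiber B g) = k, contradicting join-criticality.
      module _ (conn : Connected G) (2≤nG : Nontrivial G) (sjc : SJC H k A₀) (g∈I : g ∈ I) where

        private
          neighbour : ∃ λ g′ → Edge G g g′ × g′ ∈ ⊤
          neighbour = neighbourIn G (Connected⇒InducedConnected⊤ G conn) (subst (2 ≤_) (sym (∣⊤∣≡n (n G))) 2≤nG) (∈⊤ {x = g})
          g′ : Fin (n G)
          g′ = proj₁ neighbour
          g-g′ : Edge G g g′
          g-g′ = proj₁ (proj₂ neighbour)
          c : Fin N
          c = combine g′ (ρ b₀)

          c-B : ∀ {x} → x ∈ B → Edge L c x
          c-B x∈B = Edge-lexᴳ (subst₂ (Edge G) (sym (π-combine g′ (ρ b₀))) (sym (over x∈B)) (Edge-sym G g-g′))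

          c∉B : c ∉ B
          c∉B c∈B = Edge⇒≢ G g-g′ (trans (sym (over c∈B)) (π-combine g′ (ρ b₀)))

          ∣Q∣≤1+k : ∣ Q ∣ ≤ suc k
          ∣Q∣≤1+k = begin
            ∣ Q ∣              ≤⟨ steinerTree-∣vs∣≤ T st (p⊆p∪q ⁅ c ⁆) (star-connected L c-B) (p⊆p∪q ⁅ c ⁆ b₀∈B) ⟩
            ∣ B ∪ ⁅ c ⁆ ∣      ≡⟨ ∣p∪⁅x⁆∣≡1+∣p∣ c∉B ⟩
            suc ∣ B ∣          ≡⟨ cong suc ∣B∣≡k ⟩
            suc k              ∎
            where open ≤-Reasoning

        fiberDistance : OverVertex Q g → Q ⊆ A → Q ≢ B → SteinerDistEq H A₀ (fiber B g) k
        fiberDistance Q-over Q⊆A Q≢B with spanningTree H (fiber-connected⁻ Q-over (SubConnected⇒InducedConnected L T T-conn))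
                                                          (ρ∈fiber Q-over (B⊆Q b₀∈B))
        ... | T′ , T′≡Y′ , T′-conn , T′-size = (T′ , T′-in , ≤-antisym (s≤s⁻¹ T′-size′) (atLeast T′ T′-in)) , atLeast
          where
          T′-in : ConnSubIn H A₀ (fiber B g) T′
          T′-in = (λ h∈ → fiberA⊆A₀ g∈I (fiber-mono Q⊆A (subst (_ ∈_) T′≡Y′ h∈)))
                 , (λ h∈ → subst (_ ∈_) (sym T′≡Y′) (fiber-mono B⊆Q h∈))
                 , T′-conn
          T′-size′ : suc (nEdges T′) ≤ suc k
          T′-size′ = ≤-trans T′-size (≤-trans (≤-reflexive (sym (∣W∣≡∣fiber∣ Q-over))) ∣Q∣≤1+k)
          atLeast : ∀ T″ → ConnSubIn H A₀ (fiber B g) T″ → k ≤ nEdges T″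
          atLeast T″ (_ , fiberB⊆T″ , T″-conn) with k ≤? nEdges T″
          ... | yes k≤e = k≤e
          ... | no  k≰e = contradiction (steinerTree-connected T st B-conn b₀∈B) Q≢B
            where
            fiberB≡T″ : fiber B g ≡ vs T″
            fiberB≡T″ = p⊆q⇒∣q∣≤∣p∣⇒p≡q fiberB⊆T″ (subst (∣ vs T″ ∣ ≤_) (sym ∣fiberB∣≡k)
                          (≤-trans (connected⇒∣vs∣≤1+nEdges T″ T″-conn) (≰⇒> k≰e)))
            B-conn : InducedConnected L B
            B-conn = fiber-connected⁺ over
                       (subst (InducedConnected H) (sym fiberB≡T″) (SubConnected⇒InducedConnected H T″ T″-conn))

        module _ {x : Fin N} (x∈Q : x ∈ Q) (x∈A : x ∈ A) (x∉B : x ∉ B) where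

          private
            Q≡B∪x : Q ≡ B ∪ ⁅ x ⁆
            Q≡B∪x = sym (p⊆q⇒∣q∣≤∣p∣⇒p≡q (λ z∈ → [ B⊆Q , (λ z∈⁅x⁆ → subst (_∈ Q) (sym (x∈⁅y⁆⇒x≡y x z∈⁅x⁆)) x∈Q) ]′
                                             (x∈p∪q⁻ B ⁅ x ⁆ z∈))
                                  (subst (∣ Q ∣ ≤_) (sym (trans (∣p∪⁅x⁆∣≡1+∣p∣ x∉B) (cong suc ∣B∣≡k))) ∣Q∣≤1+k))

            Q-split : ∀ {z} → z ∈ Q → z ∈ B ⊎ z ≡ x
            Q-split {z} z∈Q = x∈p∪⁅y⁆⁻ (subst (z ∈_) Q≡B∪x z∈Q)

            Q⊆A : Q ⊆ A
            Q⊆A z∈Q = [ B⊆A , (λ { refl → x∈A }) ]′ (Q-split z∈Q)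

            Q≢B : Q ≢ B
            Q≢B Q≡B = x∉B (subst (x ∈_) Q≡B x∈Q)

            Q-over : π x ≡ g → OverVertex Q g
            Q-over πx≡g z∈Q = [ over , (λ { refl → πx≡g }) ]′ (Q-split z∈Q)

          -- x is joined in T to some y ∈ B: an edge of G from π x ∈ S to g ∈ I is impossible,
          -- and an edge inside the fibre gives the forbidden Steiner distance.
          isolatedFiber-noExtraVertex : Data.Empty.⊥
          isolatedFiber-noExtraVertex =
            viaEdge (proj₂ (firstStep (T-conn x∈Q (B⊆Q b₀∈B)) λ x≡b₀ → x∉B (subst (_∈ B) (sym x≡b₀) b₀∈B)))
            where
            viaEdge : ∀ {y} → SubEdge T x y → Data.Empty.⊥
            viaEdge {y} x-y = [ toB , (λ y≡x → Edge⇒≢ L e (sym y≡x)) ]′ (Q-split y∈Q)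
              where
              e : Edge L x y
              e = proj₁ (SubEdge⇒Edge L T x-y)
              y∈Q : y ∈ Q
              y∈Q = proj₂ (proj₂ (SubEdge⇒Edge L T x-y))
              toB : y ∈ B → Data.Empty.⊥
              toB y∈B = [ (λ eᴳ → proj₂ (∈isolated⁻ G S g∈I) (proj₁ (∈⊠⁻ {p = S} {q = ⊤} (A⊆S⊠⊤ x∈A)))
                                     (subst (Edge G (π x)) (over y∈B) eᴳ))
                        , (λ (πx≡πy , _) → proj₂ sjc (fiber B g) (⊆-trans (fiber-mono B⊆A) (fiberA⊆A₀ g∈I)) ∣fiberB∣≡k
                                             (fiberDistance (Q-over (trans πx≡πy (over y∈B))) Q⊆A Q≢B))
                        ]′ (Edge-lex⁻ e)

        isolatedFiber : Q ∩ A ≡ B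
        isolatedFiber = ⊆-antisym Q∩A⊆B (λ x∈B → x∈p∩q⁺ (B⊆Q x∈B , B⊆A x∈B))
          where
          Q∩A⊆B : Q ∩ A ⊆ B
          Q∩A⊆B {x} x∈ = decidable-stable (x ∈? B) (isolatedFiber-noExtraVertex x∈Q x∈A)
            where
            x∈Q : x ∈ Q
            x∈Q = proj₁ (x∈p∩q⁻ Q A x∈)
            x∈A : x ∈ A
            x∈A = proj₂ (x∈p∩q⁻ Q A x∈)

      singleFiber : Connected G → Nontrivial G → SJC H k A₀ → SteinerClique H k C₀ → Q ∩ A ≡ B
      singleFiber conn 2≤nG sjc clique =
        [ (λ b₀∈I⊠A₀ → isolatedFiber conn 2≤nG sjc (g∈ (proj₁ (∈⊠⁻ {p = I} {q = A₀} b₀∈I⊠A₀))))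
        , (λ b₀∈J⊠C₀ → trans (cong (_∩ A) (nonIsolatedFiber clique (g∈ (proj₁ (∈⊠⁻ {p = J} {q = C₀} b₀∈J⊠C₀)))))
                             (p⊆q⇒p∩q≡p B⊆A))
        ]′ (x∈p∪q⁻ (I ⊠ A₀) (J ⊠ C₀) (B⊆A b₀∈B))
        where
        g∈ : ∀ {V} → π b₀ ∈ V → g ∈ V
        g∈ = subst (_∈ _) (over b₀∈B)

    A-sgp : Connected G → Nontrivial G → ∀ {k} → 2 ≤ k → SJC H k A₀ → SteinerClique H k C₀ →
            SGPRange G 2 k S → SGP L k A
    A-sgp conn 2≤nG {k} 2≤k sjc clique range B B⊆A ∣B∣≡k T st with 2 ≤? ∣ image π B ∣
    ... | yes 2≤t = steinerTree∩A≡B T st 2≤t (range _ 2≤t (subst (_ ≤_) ∣B∣≡k (∣image∣≤∣p∣ π B))) A⊆S⊠⊤ B⊆A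
    ... | no  2≰t with 1≤∣p∣⇒Nonempty (subst (1 ≤_) (sym ∣B∣≡k) (≤-trans (s≤s z≤n) 2≤k))
    ...   | _ , b₀∈B = singleFiber B⊆A ∣B∣≡k (oneFiber 2≰t b₀∈B) b₀∈B T st conn 2≤nG sjc clique

  sgp≥isolatedBound : Connected G → Nontrivial G → ∀ {k s a b} → 2 ≤ k →
    IsMaxSize (SGP L k) s → IsMaxSize (SJC H k) a → IsMaxSize (SteinerClique H k) b →
    ∀ S → SGPRange G 2 k S → ∣ isolated G S ∣ * a + ∣ nonIsolated G S ∣ * b ≤ s
  sgp≥isolatedBound conn 2≤nG {s = s} 2≤k (_ , maximal) ((A₀ , sjc , ∣A₀∣≡a) , _) ((C₀ , clique , ∣C₀∣≡b) , _)
                    S range =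
    subst (_≤ s) (trans (∣A∣≡∣I∣*∣A₀∣+∣J∣*∣C₀∣ S A₀ C₀)
                        (cong₂ (λ a b → ∣ isolated G S ∣ * a + ∣ nonIsolated G S ∣ * b) ∣A₀∣≡a ∣C₀∣≡b))
      (maximal (A S A₀ C₀) (A-sgp S A₀ C₀ conn 2≤nG 2≤k sjc clique range))

  sgp≥preimageBound : ∀ {k s r} → n H < k → IsMaxSize (SGP L k) s →
    IsMaxSize (SGPRange G (ceilDiv k (n H)) (k ⊓ n G)) r → r * n H ≤ s
  sgp≥preimageBound {s = s} nH<k (_ , maximal) ((S , range , ∣S∣≡r) , _) =
    subst (_≤ s) (trans (∣p⊠q∣≡∣p∣*∣q∣ S ⊤) (cong₂ _*_ ∣S∣≡r (∣⊤∣≡n (n H)))) (maximal (S ⊠ ⊤) (preimage-sgp nH<k range))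

  sgp≡preimageBound : Connected G → Nontrivial G → Nontrivial H → ∀ {k s r} → (n G ∸ 1) * n H < k →
    IsMaxSize (SGP L k) s → IsMaxSize (SGPRange G (ceilDiv k (n H)) (k ⊓ n G)) r → s ≡ r * n H
  sgp≡preimageBound conn 2≤nG 2≤nH k-large s-max r-max =
    trans (IsMaxSize-⊤ s-max (⊤-sgp k-large conn 2≤nG))
          (cong (_* n H) (sym (IsMaxSize-⊤ r-max (⊤-sgpRange k-large 2≤nH))))

theorem5p2 : (G H : Graph) → Nontrivial G → Nontrivial H → Connected G →
    (k : ℕ) → 2 ≤ k → k < n G * n H →
    ((k ≤ n H) →
      ∀ s a b → IsMaxSize (SGP (lex G H) k) s →
        IsMaxSize (SJC H k) a → IsMaxSize (SteinerClique H k) b →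
        ∀ (S : Subset (n G)) → SGPRange G 2 k S →
        ∣ isolated G S ∣ * a + ∣ nonIsolated G S ∣ * b ≤ s)
    × ((n H < k) →
      ∀ s r → IsMaxSize (SGP (lex G H) k) s →
        IsMaxSize (SGPRange G (ceilDiv k (n H)) (k ⊓ n G)) r →
        r * n H ≤ s)
    × ((n G ∸ 1) * n H < k →
      ∀ s r → IsMaxSize (SGP (lex G H) k) s →
        IsMaxSize (SGPRange G (ceilDiv k (n H)) (k ⊓ n G)) r →
        s ≡ r * n H)
theorem5p2 G H 2≤nG 2≤nH conn k 2≤k _ =
    (λ _ _ _ _ → sgp≥isolatedBound conn 2≤nG 2≤k)
  , (λ nH<k _ _ → sgp≥preimageBound nH<k)
  , (λ k-large _ _ → sgp≡preimageBound conn 2≤nG 2≤nH k-large)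
  where open LexicographicSGP G H
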